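{- Let $m\geq 3$ and $n\in \mathbb{N}=\{1,2,\dots\}$. Then \[ \sigma'_m(n) = -n\, e_{m+2,n}+\sum_{k=1}^{n-1} (-1)^{k+1} \big( \sigma'_m(n-P_{m+2,k})+\sigma'_m(n- Q_{m+2,k}) \big), \] where $P_{g,k}=\frac{k((g-2)k-(g-4))}{2}$, $Q_{g,k}=\frac{k((g-2)k+(g-4))}{2}$, and $e_{g,n}=1$ if $n=0$, $e_{g,n}=(-1)^k$ if $n=P_{g,k}$ or $n=Q_{g,k}$ for some $k\in\mathbb{N}$, and $e_{g,n}=0$ otherwise.
   Context: For $m\ge3$ and $n\in\mathbb{N}$, $\sigma'_m(n)$ is the sum of the positive divisors $d$ of $n$ with $d\equiv 0$, $1$ or $m-1\pmod m$; convention $\sigma'_m(x)=0$ for integers $x\le 0$. -}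

module Defs where

open import Data.Nat as ℕ using (ℕ; zero; suc; _≡ᵇ_; _∸_; _+_; _*_; _≤ᵇ_)
open import Data.Nat.DivMod using (_%_; _/_)
open import Data.Nat.Divisibility using (_∣?_)
open import Data.Nat.ListAction using (sum)
open import Data.Bool using (Bool; true; false; if_then_else_; _∨_; _∧_)
open import Data.List using (List; filter; applyUpTo)
open import Data.Integer as ℤ using (ℤ; +_; -[1+_])
open import Relation.Nullary.Decidable using (⌊_⌋)
open import Data.Bool using (T?)

sgn : ℕ → ℤ
sgn zero = + 1
sgn (suc zero) = ℤ.- (+ 1)
sgn (suc (suc k)) = sgn k

-- the residue condition d ≡ 0, 1 or m-1 (mod m)
-- (for m = 0 the modulus is replaced by 1; irrelevant since m ≥ 3 throughout)
good : ℕ → ℕ → Bool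
good m d = ((d % M) ≡ᵇ 0) ∨ ((d % M) ≡ᵇ 1) ∨ ((d % M) ≡ᵇ (M ∸ 1))
  where M = suc (m ∸ 1)

σ'ℕ : (m : ℕ) → ℕ → ℕ
σ'ℕ m n = sum (filter (λ d → T? (⌊ d ∣? n ⌋ ∧ good m d)) (applyUpTo suc n))

-- σ'_m extended to integers, with σ'_m(x) = 0 for x ≤ 0
σ' : (m : ℕ) → ℤ → ℤ
σ' m (+ n) = + σ'ℕ m n
σ' m -[1+ _ ] = + 0

-- P_{g,k} = k((g-2)k-(g-4))/2 and Q_{g,k} = k((g-2)k+(g-4))/2.
-- Used only for g ≥ 5 and k ≥ 1, where (g-2)k ≥ g-4 ≥ 1, so truncated
-- subtraction is exact and the numerators are even, so division is exact.
P : ℕ → ℕ → ℕ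
P g k = (k * ((g ∸ 2) * k ∸ (g ∸ 4))) / 2

Q : ℕ → ℕ → ℕ
Q g k = (k * ((g ∸ 2) * k + (g ∸ 4))) / 2

-- For g ≥ 5, P_{g,k} ≥ k and Q_{g,k} ≥ k, so it suffices to search k ≤ n;
-- the search returns the sign for the least such k.
e-search : ℕ → ℕ → List ℕ → ℤ
e-search g n Data.List.[] = + 0
e-search g n (k Data.List.∷ ks) =
  if (P g k ≡ᵇ n) ∨ (Q g k ≡ᵇ n) then sgn k else e-search g n ks

e : ℕ → ℕ → ℤ
e g zero = + 1
e g (suc n) = e-search g (suc n) (applyUpTo suc (suc n))

sum₁ : ℕ → (ℕ → ℤ) → ℤ
sum₁ zero f = + 0
sum₁ (suc N) f = sum₁ N f ℤ.+ f (suc N)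

-- Let A = ∏ (1 - q^d) over the d ≥ 1 with d ≡ 0, ±1 (mod m). Its negative logarithmic derivative
-- L = - q A′ / A is Σ_t σ'_m(t) q^t, so the coefficient of q^n in q A′ + A L = 0 reads
-- n a_n + Σ_j a_j σ'_m(n - j) = 0, and it remains to show a_j = e_{m+2,j}.
-- Grouping the factors in blocks of m, the factors up to d = mN form
-- (q^m;q^m)_N ∏_{k<N} (1 - q^{mk+1}) (1 - q^{mk+m-1}), and a finite form of Jacobi's triple
-- product expands the latter as Σ_{|k| ≤ N} (-1)^k q^{P_{m+2,k}} [2N, N+k]_{q^m}, where
-- P_{m+2,-k} = Q_{m+2,k}. As (q^m;q^m)_N [2N, N+k]_{q^m} ≡ 1 modulo q^{m(N-|k|+1)}, the
-- coefficients of A below q^{n+1} are those of Σ_k (-1)^k q^{P_{m+2,k}}, for N = 2n.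

module Submission where

open import Data.Bool using (Bool; true; false; if_then_else_; _∨_; _∧_; T; T?)
open import Data.Bool.Properties using (∨-zeroʳ)
open import Data.Empty using (⊥-elim)
open import Data.Integer as ℤ using (ℤ; +_; -[1+_]; _+_; _*_; _-_; -_)
import Data.Integer.Properties as ℤP
open import Data.Integer.Tactic.RingSolver using (solve-∀)
open import Data.List using ([]; _∷_; _++_; filter; applyUpTo)
open import Data.List.Properties using (applyUpTo-∷ʳ; filter-++)
import Data.Nat.Tactic.RingSolver as ℕSolver
open import Data.Nat as ℕ using (ℕ; zero; suc; z≤n; s≤s)
open import Data.Nat.Divisibility using (_∣_; _∣?_; ∣-refl; ∣⇒≤; ∣m∣n⇒∣m+n; ∣m+n∣m⇒∣n)
open import Data.Nat.DivMod using (_%_; _/_; [m+kn]%n≡m%n; m<n⇒m%n≡m; m*n/n≡m)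
open import Data.Nat.Induction using (<-rec)
open import Data.Nat.ListAction using (sum)
open import Data.Nat.ListAction.Properties using (sum-++)
import Data.Nat.Properties as ℕP
open import Data.Product using (_,_)
open import Data.Sum using (_⊎_; inj₁; inj₂)
open import Function using (_∘_)
open import Relation.Binary.Bundles using (Setoid)
open import Relation.Binary.Definitions using (tri<; tri≈; tri>)
import Relation.Binary.Reasoning.Setoid as SetoidReasoning
open import Relation.Binary.PropositionalEquality
open import Relation.Nullary using (¬_; Dec; yes; no)
open import Relation.Nullary.Decidable using (⌊_⌋)

open import Defs

cong₃ : ∀ {A B C D : Set} (f : A → B → C → D) {x x′ y y′ z z′} →
        x ≡ x′ → y ≡ y′ → z ≡ z′ → f x y z ≡ f x′ y′ z′
cong₃ f refl refl refl = refl

Series : Set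
Series = ℕ → ℤ

infix 4 _≈_ _≈[_]_

_≈_ : Series → Series → Set
f ≈ g = ∀ i → f i ≡ g i

_≈[_]_ : Series → ℕ → Series → Set
f ≈[ t ] g = ∀ i → i ℕ.< t → f i ≡ g i

≈-refl : ∀ {f} → f ≈ f
≈-refl i = refl

≈-sym : ∀ {f g} → f ≈ g → g ≈ f
≈-sym p i = sym (p i)

≈-trans : ∀ {f g h} → f ≈ g → g ≈ h → f ≈ h
≈-trans p q i = trans (p i) (q i)

≈-setoid : Setoid _ _
≈-setoid = record
  { Carrier = Series
  ; _≈_ = _≈_
  ; isEquivalence = record { refl = ≈-refl ; sym = ≈-sym ; trans = ≈-trans }
  }

module ≈-Reasoning = SetoidReasoning ≈-setoid

≈[]-refl : ∀ {f t} → f ≈[ t ] f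
≈[]-refl i _ = refl

≈[]-sym : ∀ {f g t} → f ≈[ t ] g → g ≈[ t ] f
≈[]-sym p i i<t = sym (p i i<t)

≈[]-trans : ∀ {f g h t} → f ≈[ t ] g → g ≈[ t ] h → f ≈[ t ] h
≈[]-trans p q i i<t = trans (p i i<t) (q i i<t)

≈⇒≈[] : ∀ {f g t} → f ≈ g → f ≈[ t ] g
≈⇒≈[] p i _ = p i

≈[]-weaken : ∀ {f g t u} → u ℕ.≤ t → f ≈[ t ] g → f ≈[ u ] g
≈[]-weaken u≤t p i i<u = p i (ℕP.<-≤-trans i<u u≤t)

0ₛ : Series
0ₛ _ = + 0

1ₛ : Series
1ₛ zero = + 1
1ₛ (suc i) = + 0

infixl 6 _⊕_ _⊝_
infixr 7 _•_

_⊕_ : Series → Series → Series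
(f ⊕ g) i = f i + g i

_⊝_ : Series → Series → Series
(f ⊝ g) i = f i - g i

_•_ : ℤ → Series → Series
(c • f) i = c * f i

q·_ : Series → Series
(q· f) zero = + 0
(q· f) (suc i) = f i

infixr 8 q·_ q^_·_ [1-q^_]_

q^_·_ : ℕ → Series → Series
q^ zero · f = f
q^ suc s · f = q· (q^ s · f)

[1-q^_]_ : ℕ → Series → Series
[1-q^ a ] f = f ⊝ q^ a · f

⊕-cong : ∀ {f f′ g g′} → f ≈ f′ → g ≈ g′ → f ⊕ g ≈ f′ ⊕ g′
⊕-cong p q i = cong₂ _+_ (p i) (q i)

⊝-cong : ∀ {f f′ g g′} → f ≈ f′ → g ≈ g′ → f ⊝ g ≈ f′ ⊝ g′
⊝-cong p q i = cong₂ _-_ (p i) (q i)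

⊕-cong-≈[] : ∀ {f f′ g g′ t} → f ≈[ t ] f′ → g ≈[ t ] g′ → f ⊕ g ≈[ t ] f′ ⊕ g′
⊕-cong-≈[] p q i i<t = cong₂ _+_ (p i i<t) (q i i<t)

record IsQLinear (op : Series → Series) : Set where
  field
    cong-≈ : ∀ {f g} → f ≈ g → op f ≈ op g
    cong-≈[] : ∀ {f g} t → f ≈[ t ] g → op f ≈[ t ] op g
    ⊕-hom : ∀ f g → op (f ⊕ g) ≈ op f ⊕ op g
    •-hom : ∀ c f → op (c • f) ≈ c • op f
    q-comm : ∀ f → op (q· f) ≈ q· op f

open IsQLinear public

module _ {op : Series → Series} (L : IsQLinear op) where

  ⊝-hom : ∀ f g → op (f ⊝ g) ≈ op f ⊝ op g
  ⊝-hom f g i = begin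
    op (f ⊝ g) i                ≡⟨ cong-≈ L (λ j → sub-as-add (f j) (g j)) i ⟩
    op (f ⊕ ℤ.-1ℤ • g) i        ≡⟨ ⊕-hom L f _ i ⟩
    op f i + op (ℤ.-1ℤ • g) i   ≡⟨ cong (_+_ (op f i)) (•-hom L ℤ.-1ℤ g i) ⟩
    op f i + ℤ.-1ℤ * op g i     ≡⟨ sub-as-add (op f i) (op g i) ⟨
    op f i - op g i             ∎
    where
    open ≡-Reasoning
    sub-as-add : ∀ x y → x - y ≡ x + ℤ.-1ℤ * y
    sub-as-add = solve-∀

  0-hom : op 0ₛ ≈ 0ₛ
  0-hom i = trans (•-hom L (+ 0) 0ₛ i) (ℤP.*-zeroˡ (op 0ₛ i))

  ≈0-hom : ∀ {f} → f ≈ 0ₛ → op f ≈ 0ₛ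
  ≈0-hom p = ≈-trans (cong-≈ L p) 0-hom

  q^-comm : ∀ s f → op (q^ s · f) ≈ q^ s · op f
  q^-comm zero f = ≈-refl
  q^-comm (suc s) f = ≈-trans (q-comm L _) (q·-cong (q^-comm s f))
    where
    q·-cong : ∀ {g h} → g ≈ h → q· g ≈ q· h
    q·-cong p zero = refl
    q·-cong p (suc i) = p i

  [1-q^]-comm : ∀ a f → op ([1-q^ a ] f) ≈ [1-q^ a ] op f
  [1-q^]-comm a f i = trans (⊝-hom f _ i) (cong (_-_ (op f i)) (q^-comm a f i))

id-linear : IsQLinear (λ f → f)
id-linear = record
  { cong-≈ = λ p → p ; cong-≈[] = λ _ p → p
  ; ⊕-hom = λ _ _ → ≈-refl ; •-hom = λ _ _ → ≈-refl ; q-comm = λ _ → ≈-refl }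

∘-linear : ∀ {op op′} → IsQLinear op → IsQLinear op′ → IsQLinear (op ∘ op′)
∘-linear L L′ = record
  { cong-≈ = cong-≈ L ∘ cong-≈ L′
  ; cong-≈[] = λ t → cong-≈[] L t ∘ cong-≈[] L′ t
  ; ⊕-hom = λ f g → ≈-trans (cong-≈ L (⊕-hom L′ f g)) (⊕-hom L _ _)
  ; •-hom = λ c f → ≈-trans (cong-≈ L (•-hom L′ c f)) (•-hom L c _)
  ; q-comm = λ f → ≈-trans (cong-≈ L (q-comm L′ f)) (q-comm L _) }

⊝-linear : ∀ {op op′} → IsQLinear op → IsQLinear op′ → IsQLinear (λ f → op f ⊝ op′ f)
⊝-linear {op} {op′} L L′ = record
  { cong-≈ = λ p i → cong₂ _-_ (cong-≈ L p i) (cong-≈ L′ p i)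
  ; cong-≈[] = λ t p i i<t → cong₂ _-_ (cong-≈[] L t p i i<t) (cong-≈[] L′ t p i i<t)
  ; ⊕-hom = λ f g i → trans (cong₂ _-_ (⊕-hom L f g i) (⊕-hom L′ f g i))
                             (interchange (op f i) (op g i) (op′ f i) (op′ g i))
  ; •-hom = λ c f i → trans (cong₂ _-_ (•-hom L c f i) (•-hom L′ c f i)) (factor c _ _)
  ; q-comm = λ { f zero → cong₂ _-_ (q-comm L f zero) (q-comm L′ f zero)
               ; f (suc i) → cong₂ _-_ (q-comm L f (suc i)) (q-comm L′ f (suc i)) } }
  where
  interchange : ∀ a b c d → (a + b) - (c + d) ≡ (a - c) + (b - d)
  interchange = solve-∀
  factor : ∀ c a b → c * a - c * b ≡ c * (a - b)
  factor = solve-∀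

q-linear : IsQLinear q·_
q-linear = record
  { cong-≈ = λ { p zero → refl ; p (suc i) → p i }
  ; cong-≈[] = λ { t p zero _ → refl ; t p (suc i) i<t → p i (ℕP.<-trans (ℕP.n<1+n i) i<t) }
  ; ⊕-hom = λ { f g zero → refl ; f g (suc i) → refl }
  ; •-hom = λ { c f zero → sym (ℤP.*-zeroʳ c) ; c f (suc i) → refl }
  ; q-comm = λ f i → refl }

q^-linear : ∀ s → IsQLinear (q^ s ·_)
q^-linear zero = id-linear
q^-linear (suc s) = ∘-linear q-linear (q^-linear s)

[1-q^]-linear : ∀ a → IsQLinear ([1-q^ a ]_)
[1-q^]-linear a = ⊝-linear id-linear (q^-linear a)

•-linear : ∀ c → IsQLinear (c •_)
•-linear c = record
  { cong-≈ = λ p i → cong (c *_) (p i)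
  ; cong-≈[] = λ t p i i<t → cong (c *_) (p i i<t)
  ; ⊕-hom = λ f g i → ℤP.*-distribˡ-+ c (f i) (g i)
  ; •-hom = λ d f i → swap c d (f i)
  ; q-comm = λ { f zero → ℤP.*-zeroʳ c ; f (suc i) → refl } }
  where
  swap : ∀ c d x → c * (d * x) ≡ d * (c * x)
  swap = solve-∀

•q^-comm : ∀ {op} → IsQLinear op → ∀ c s f → op (c • q^ s · f) ≈ c • q^ s · op f
•q^-comm L c s f = ≈-trans (•-hom L c _) (cong-≈ (•-linear c) (q^-comm L s f))

data ShiftView (s : ℕ) : ℕ → Set where
  below : ∀ {i} → i ℕ.< s → ShiftView s i
  above : ∀ j → ShiftView s (s ℕ.+ j)

shiftView : ∀ s i → ShiftView s i
shiftView s i with i ℕ.<? s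
... | yes i<s = below i<s
... | no i≮s with ℕP.m≤n⇒∃[o]m+o≡n (ℕP.≮⇒≥ i≮s)
...   | j , refl = above j

q^-below : ∀ s f {i} → i ℕ.< s → (q^ s · f) i ≡ + 0
q^-below (suc s) f {zero} _ = refl
q^-below (suc s) f {suc i} (s≤s i<s) = q^-below s f i<s

q^-above : ∀ s f j → (q^ s · f) (s ℕ.+ j) ≡ f j
q^-above zero f j = refl
q^-above (suc s) f j = q^-above s f j

q^-+ : ∀ s t f → q^ (s ℕ.+ t) · f ≈ q^ s · q^ t · f
q^-+ zero t f = ≈-refl
q^-+ (suc s) t f = cong-≈ q-linear (q^-+ s t f)

q^-cong : ∀ {s t} f → s ≡ t → q^ s · f ≈ q^ t · f
q^-cong f refl = ≈-refl

q^-exchange : ∀ a e e′ d f → a ℕ.+ e ≡ e′ ℕ.+ d → q^ a · q^ e · f ≈ q^ e′ · q^ d · f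
q^-exchange a e e′ d f eq = ≈-trans (≈-sym (q^-+ a e f)) (≈-trans (q^-cong f eq) (q^-+ e′ d f))

q^q^-vanish : ∀ a e e′ d {X} → X ≈ 0ₛ → q^ a · q^ e · X ≈ q^ e′ · q^ d · X
q^q^-vanish a e e′ d X≈0 =
  ≈-trans (≈0-hom (∘-linear (q^-linear a) (q^-linear e)) X≈0)
          (≈-sym (≈0-hom (∘-linear (q^-linear e′) (q^-linear d)) X≈0))

q^-≈[] : ∀ s t {f g} → f ≈[ t ] g → q^ s · f ≈[ s ℕ.+ t ] q^ s · g
q^-≈[] zero t p = p
q^-≈[] (suc s) t p zero _ = refl
q^-≈[] (suc s) t p (suc i) (s≤s i<s+t) = q^-≈[] s t p i i<s+t

q^-≈[]-below : ∀ s f g → q^ s · f ≈[ s ] q^ s · g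
q^-≈[]-below s f g i i<s = trans (q^-below s f i<s) (sym (q^-below s g i<s))

q^-≈[]-enough : ∀ s t n {f g} → f ≈[ t ] g → (s ℕ.≤ n → n ℕ.< s ℕ.+ t) → q^ s · f ≈[ suc n ] q^ s · g
q^-≈[]-enough s t n p enough with s ℕ.≤? n
... | yes s≤n = ≈[]-weaken (enough s≤n) (q^-≈[] s t p)
... | no s≰n = ≈[]-weaken (ℕP.≰⇒> s≰n) (q^-≈[]-below s _ _)

[1-q^]-cong : ∀ {a b} f → a ≡ b → [1-q^ a ] f ≈ [1-q^ b ] f
[1-q^]-cong f refl = ≈-refl

[1-q^]-below : ∀ a t f → t ℕ.≤ a → [1-q^ a ] f ≈[ t ] f
[1-q^]-below a t f t≤a i i<t =
  trans (cong (_-_ (f i)) (q^-below a f (ℕP.<-≤-trans i<t t≤a))) (ℤP.+-identityʳ (f i))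

[1-q^]-cancel : ∀ a t {f g} → 1 ℕ.≤ a → [1-q^ a ] f ≈[ t ] [1-q^ a ] g → f ≈[ t ] g
[1-q^]-cancel a t {f} {g} 1≤a p = <-rec (λ i → i ℕ.< t → f i ≡ g i) step
  where
  open ≡-Reasoning
  restore : ∀ x y → x ≡ (x - y) + y
  restore = solve-∀
  from-shifted : ∀ i → i ℕ.< t → (q^ a · f) i ≡ (q^ a · g) i → f i ≡ g i
  from-shifted i i<t eq = begin
    f i                                ≡⟨ restore (f i) _ ⟩
    ([1-q^ a ] f) i + (q^ a · f) i     ≡⟨ cong₂ _+_ (p i i<t) eq ⟩
    ([1-q^ a ] g) i + (q^ a · g) i     ≡⟨ restore (g i) _ ⟨
    g i                                ∎
  step : ∀ i → (∀ {j} → j ℕ.< i → j ℕ.< t → f j ≡ g j) → i ℕ.< t → f i ≡ g i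
  step i ih i<t with shiftView a i
  ... | below i<a = from-shifted i i<t (q^-≈[]-below a f g i i<a)
  ... | above j = from-shifted (a ℕ.+ j) i<t (begin
    (q^ a · f) (a ℕ.+ j)   ≡⟨ q^-above a f j ⟩
    f j                    ≡⟨ ih (ℕP.m<n+m j 1≤a) (ℕP.≤-<-trans (ℕP.m≤n+m j a) i<t) ⟩
    g j                    ≡⟨ q^-above a g j ⟨
    (q^ a · g) (a ℕ.+ j)   ∎)

[1-q^]-+ : ∀ c d f → [1-q^ c ] f ⊕ q^ c · [1-q^ d ] f ≈ [1-q^ (c ℕ.+ d) ] f
[1-q^]-+ c d f i = begin
  (f i - (q^ c · f) i) + (q^ c · [1-q^ d ] f) i
    ≡⟨ cong (_+_ (f i - (q^ c · f) i)) (⊝-hom (q^-linear c) f _ i) ⟩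
  (f i - (q^ c · f) i) + ((q^ c · f) i - (q^ c · q^ d · f) i)
    ≡⟨ cong (λ z → (f i - (q^ c · f) i) + ((q^ c · f) i - z)) (q^-+ c d f i) ⟨
  (f i - (q^ c · f) i) + ((q^ c · f) i - (q^ (c ℕ.+ d) · f) i)
    ≡⟨ telescope (f i) _ _ ⟩
  f i - (q^ (c ℕ.+ d) · f) i ∎
  where
  open ≡-Reasoning
  telescope : ∀ x y z → (x - y) + (y - z) ≡ x - z
  telescope = solve-∀

[1-q^]-[1-q^] : ∀ a b f → [1-q^ a ] [1-q^ b ] f ≈ ((f ⊕ q^ (a ℕ.+ b) · f) ⊝ q^ a · f) ⊝ q^ b · f
[1-q^]-[1-q^] a b f i = begin
  (f i - (q^ b · f) i) - (q^ a · [1-q^ b ] f) i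
    ≡⟨ cong (_-_ (f i - (q^ b · f) i)) (⊝-hom (q^-linear a) f _ i) ⟩
  (f i - (q^ b · f) i) - ((q^ a · f) i - (q^ a · q^ b · f) i)
    ≡⟨ cong (λ z → (f i - (q^ b · f) i) - ((q^ a · f) i - z)) (q^-+ a b f i) ⟨
  (f i - (q^ b · f) i) - ((q^ a · f) i - (q^ (a ℕ.+ b) · f) i)
    ≡⟨ expand (f i) _ _ _ ⟩
  ((f i + (q^ (a ℕ.+ b) · f) i) - (q^ a · f) i) - (q^ b · f) i ∎
  where
  open ≡-Reasoning
  expand : ∀ x y z w → (x - y) - (z - w) ≡ ((x + w) - z) - y
  expand = solve-∀

-- Σℤ lo L h = Σ_{k = lo}^{lo + L - 1} h k
Σℤ : ℤ → ℕ → (ℤ → ℤ) → ℤ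
Σℤ lo zero h = + 0
Σℤ lo (suc L) h = h lo + Σℤ (lo + + 1) L h

Σℤ-cong : ∀ lo L {h h′} → (∀ k → h k ≡ h′ k) → Σℤ lo L h ≡ Σℤ lo L h′
Σℤ-cong lo zero p = refl
Σℤ-cong lo (suc L) p = cong₂ _+_ (p lo) (Σℤ-cong (lo + + 1) L p)

Σℤ-+ : ∀ lo L h h′ → Σℤ lo L (λ k → h k + h′ k) ≡ Σℤ lo L h + Σℤ lo L h′
Σℤ-+ lo zero h h′ = refl
Σℤ-+ lo (suc L) h h′ =
  trans (cong (_+_ (h lo + h′ lo)) (Σℤ-+ (lo + + 1) L h h′)) (interchange (h lo) (h′ lo) _ _)
  where
  interchange : ∀ a b c d → (a + b) + (c + d) ≡ (a + c) + (b + d)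
  interchange = solve-∀

Σℤ-neg : ∀ lo L h → Σℤ lo L (λ k → - h k) ≡ - Σℤ lo L h
Σℤ-neg lo zero h = refl
Σℤ-neg lo (suc L) h =
  trans (cong (_+_ (- h lo)) (Σℤ-neg (lo + + 1) L h)) (sym (ℤP.neg-distrib-+ (h lo) _))

Σℤ-shift : ∀ lo L h c → Σℤ lo L (λ k → h (k + c)) ≡ Σℤ (lo + c) L h
Σℤ-shift lo zero h c = refl
Σℤ-shift lo (suc L) h c =
  cong (_+_ (h (lo + c))) (trans (Σℤ-shift (lo + + 1) L h c) (cong (λ z → Σℤ z L h) (swap lo c)))
  where
  swap : ∀ x y → (x + + 1) + y ≡ (x + y) + + 1
  swap = solve-∀

Σℤ-snoc : ∀ lo L h → Σℤ lo (suc L) h ≡ Σℤ lo L h + h (lo + + L)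
Σℤ-snoc lo zero h =
  trans (ℤP.+-identityʳ (h lo)) (trans (cong h (sym (ℤP.+-identityʳ lo))) (sym (ℤP.+-identityˡ _)))
Σℤ-snoc lo (suc L) h =
  trans (cong (_+_ (h lo)) (Σℤ-snoc (lo + + 1) L h))
    (trans (sym (ℤP.+-assoc (h lo) _ _)) (cong (λ z → (h lo + Σℤ (lo + + 1) L h) + h z) (ℤP.+-assoc lo (+ 1) (+ L))))

Σₛ : ℤ → ℕ → (ℤ → Series) → Series
Σₛ lo L F i = Σℤ lo L (λ k → F k i)

Σₛ-cong : ∀ lo L {F G} → (∀ k → F k ≈ G k) → Σₛ lo L F ≈ Σₛ lo L G
Σₛ-cong lo L p i = Σℤ-cong lo L (λ k → p k i)

Σₛ-⊕ : ∀ lo L F G → Σₛ lo L (λ k → F k ⊕ G k) ≈ Σₛ lo L F ⊕ Σₛ lo L G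
Σₛ-⊕ lo L F G i = Σℤ-+ lo L (λ k → F k i) (λ k → G k i)

Σₛ-⊝ : ∀ lo L F G → Σₛ lo L (λ k → F k ⊝ G k) ≈ Σₛ lo L F ⊝ Σₛ lo L G
Σₛ-⊝ lo L F G i =
  trans (Σℤ-+ lo L (λ k → F k i) (λ k → - G k i)) (cong (_+_ (Σₛ lo L F i)) (Σℤ-neg lo L (λ k → G k i)))

Σₛ-shift : ∀ lo L F c → Σₛ lo L (λ k → F (k + c)) ≈ Σₛ (lo + c) L F
Σₛ-shift lo L F c i = Σℤ-shift lo L (λ k → F k i) c

Σₛ-comm : ∀ {op} → IsQLinear op → ∀ lo L F → op (Σₛ lo L F) ≈ Σₛ lo L (op ∘ F)
Σₛ-comm L lo zero F = 0-hom L
Σₛ-comm {op} L lo (suc n) F i =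
  trans (⊕-hom L (F lo) (Σₛ (lo + + 1) n F) i) (cong (_+_ (op (F lo) i)) (Σₛ-comm L (lo + + 1) n F i))

Σₛ-drop-first : ∀ lo L F → F lo ≈ 0ₛ → Σₛ lo (suc L) F ≈ Σₛ (lo + + 1) L F
Σₛ-drop-first lo L F F≈0 i = trans (cong (_+ Σₛ (lo + + 1) L F i) (F≈0 i)) (ℤP.+-identityˡ _)

Σₛ-drop-last : ∀ lo L F → F (lo + + L) ≈ 0ₛ → Σₛ lo (suc L) F ≈ Σₛ lo L F
Σₛ-drop-last lo L F F≈0 i =
  trans (Σℤ-snoc lo L (λ k → F k i)) (trans (cong (_+_ (Σₛ lo L F i)) (F≈0 i)) (ℤP.+-identityʳ _))

Σₛ-index : ∀ {lo lo′ L L′} F → lo ≡ lo′ → L ≡ L′ → Σₛ lo L F ≈ Σₛ lo′ L′ F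
Σₛ-index F refl refl = ≈-refl

sum₁-cong : ∀ N {f g} → (∀ x → 1 ℕ.≤ x → x ℕ.≤ N → f x ≡ g x) → sum₁ N f ≡ sum₁ N g
sum₁-cong zero p = refl
sum₁-cong (suc N) p =
  cong₂ _+_ (sum₁-cong N (λ x 1≤x x≤N → p x 1≤x (ℕP.m≤n⇒m≤1+n x≤N))) (p (suc N) (s≤s z≤n) ℕP.≤-refl)

sum₁-neg : ∀ N f → sum₁ N (λ x → - f x) ≡ - sum₁ N f
sum₁-neg zero f = refl
sum₁-neg (suc N) f = trans (cong (_+ - f (suc N)) (sum₁-neg N f)) (sym (ℤP.neg-distrib-+ (sum₁ N f) (f (suc N))))

sum₁-front : ∀ N f → sum₁ (suc N) f ≡ f 1 + sum₁ N (f ∘ suc)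
sum₁-front zero f = trans (ℤP.+-identityˡ (f 1)) (sym (ℤP.+-identityʳ (f 1)))
sum₁-front (suc N) f = trans (cong (_+ f (suc (suc N))) (sum₁-front N f)) (ℤP.+-assoc (f 1) _ _)

sum₁-vanishing-tail : ∀ K r f → (∀ x → K ℕ.< x → x ℕ.≤ K ℕ.+ r → f x ≡ + 0) → sum₁ (K ℕ.+ r) f ≡ sum₁ K f
sum₁-vanishing-tail K zero f _ = cong (λ w → sum₁ w f) (ℕP.+-identityʳ K)
sum₁-vanishing-tail K (suc r) f vanish rewrite ℕP.+-suc K r =
  trans (cong₂ _+_ (sum₁-vanishing-tail K r f (λ x K<x x≤K+r → vanish x K<x (ℕP.m≤n⇒m≤1+n x≤K+r)))
                   (vanish (suc (K ℕ.+ r)) (s≤s (ℕP.m≤m+n K r)) ℕP.≤-refl))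
        (ℤP.+-identityʳ _)

Σℤ-symmetric : ∀ N h → Σℤ (- + N) (suc (N ℕ.+ N)) h ≡ h (+ 0) + sum₁ N (λ x → h (+ x) + h (- + x))
Σℤ-symmetric zero h = refl
Σℤ-symmetric (suc N) h = begin
  h lo + Σℤ (lo + + 1) (suc (N ℕ.+ suc N)) h
    ≡⟨ cong (_+_ (h lo)) (Σℤ-snoc (lo + + 1) (N ℕ.+ suc N) h) ⟩
  h lo + (Σℤ (lo + + 1) (N ℕ.+ suc N) h + h ((lo + + 1) + + (N ℕ.+ suc N)))
    ≡⟨ cong₂ (λ u v → h lo + (u + h v))
         (trans (cong₂ (λ p q → Σℤ p q h) (e₁ (+ N)) (ℕP.+-suc N N)) (Σℤ-symmetric N h))
         (trans (cong (_+_ (lo + + 1)) (ℤP.pos-+ N (suc N))) (e₂ (+ N))) ⟩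
  h lo + ((h (+ 0) + sum₁ N g) + h (+ suc N))
    ≡⟨ regroup (h lo) (h (+ 0)) (sum₁ N g) (h (+ suc N)) ⟩
  h (+ 0) + (sum₁ N g + (h (+ suc N) + h lo)) ∎
  where
  open ≡-Reasoning
  lo = - + suc N
  g = λ x → h (+ x) + h (- + x)
  e₁ : ∀ n → - (+ 1 + n) + + 1 ≡ - n
  e₁ = solve-∀
  e₂ : ∀ n → - (+ 1 + n) + + 1 + (n + (+ 1 + n)) ≡ + 1 + n
  e₂ = solve-∀
  regroup : ∀ a b c d → a + ((b + c) + d) ≡ b + (c + (d + a))
  regroup = solve-∀

Σ₁ₛ : ℕ → (ℕ → Series) → Series
Σ₁ₛ N G i = sum₁ N (λ x → G x i)

Σ₁ₛ-comm : ∀ {op} → IsQLinear op → ∀ N G → op (Σ₁ₛ N G) ≈ Σ₁ₛ N (op ∘ G)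
Σ₁ₛ-comm L zero G = 0-hom L
Σ₁ₛ-comm {op} L (suc N) G i =
  trans (⊕-hom L (Σ₁ₛ N G) (G (suc N)) i) (cong (_+ op (G (suc N)) i) (Σ₁ₛ-comm L N G i))

Σ₁ₛ-cong-≈[] : ∀ N t {F G} → (∀ x → 1 ℕ.≤ x → x ℕ.≤ N → F x ≈[ t ] G x) → Σ₁ₛ N F ≈[ t ] Σ₁ₛ N G
Σ₁ₛ-cong-≈[] N t p i i<t = sum₁-cong N (λ x 1≤x x≤N → p x 1≤x x≤N i i<t)

Σ< : ℕ → (ℕ → ℤ) → ℤ
Σ< zero h = + 0
Σ< (suc n) h = Σ< n h + h n

Σ<-front : ∀ n h → Σ< (suc n) h ≡ h 0 + Σ< n (h ∘ suc)
Σ<-front zero h = trans (ℤP.+-identityˡ (h 0)) (sym (ℤP.+-identityʳ (h 0)))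
Σ<-front (suc n) h = trans (cong (_+ h (suc n)) (Σ<-front n h)) (ℤP.+-assoc (h 0) _ _)

Σ<-cong : ∀ n {h h′} → (∀ j → j ℕ.< n → h j ≡ h′ j) → Σ< n h ≡ Σ< n h′
Σ<-cong zero p = refl
Σ<-cong (suc n) p = cong₂ _+_ (Σ<-cong n (λ j j<n → p j (ℕP.m<n⇒m<1+n j<n))) (p n ℕP.≤-refl)

Σ<-reverse : ∀ n h → Σ< n h ≡ Σ< n (λ j → h (n ℕ.∸ suc j))
Σ<-reverse zero h = refl
Σ<-reverse (suc n) h =
  trans (cong (_+ h n) (Σ<-reverse n h)) (trans (ℤP.+-comm _ (h n)) (sym (Σ<-front n (λ j → h (suc n ℕ.∸ suc j)))))

Σ<-+ : ∀ n h h′ → Σ< n (λ j → h j + h′ j) ≡ Σ< n h + Σ< n h′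
Σ<-+ zero h h′ = refl
Σ<-+ (suc n) h h′ = trans (cong (_+ (h n + h′ n)) (Σ<-+ n h h′)) (interchange (Σ< n h) (Σ< n h′) (h n) (h′ n))
  where
  interchange : ∀ a b c d → (a + b) + (c + d) ≡ (a + c) + (b + d)
  interchange = solve-∀

Σ<-* : ∀ n c h → Σ< n (λ j → c * h j) ≡ c * Σ< n h
Σ<-* zero c h = sym (ℤP.*-zeroʳ c)
Σ<-* (suc n) c h = trans (cong (_+ c * h n) (Σ<-* n c h)) (sym (ℤP.*-distribˡ-+ c _ _))

Σ<-zero : ∀ n h → (∀ j → h j ≡ + 0) → Σ< n h ≡ + 0
Σ<-zero zero h _ = refl
Σ<-zero (suc n) h h≡0 = cong₂ _+_ (Σ<-zero n h h≡0) (h≡0 n)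

sum₁-Σ< : ∀ N f → sum₁ N f ≡ Σ< N (f ∘ suc)
sum₁-Σ< zero f = refl
sum₁-Σ< (suc N) f = cong (_+ f (suc N)) (sum₁-Σ< N f)

infixl 7 _⊛_

_⊛_ : Series → Series → Series
(f ⊛ g) i = Σ< (suc i) (λ j → f j * g (i ℕ.∸ j))

⊛-linearˡ : ∀ g → IsQLinear (_⊛ g)
⊛-linearˡ g = record
  { cong-≈ = λ p i → Σ<-cong (suc i) (λ j _ → cong (_* g (i ℕ.∸ j)) (p j))
  ; cong-≈[] = λ t p i i<t → Σ<-cong (suc i) (λ j j≤i → cong (_* g (i ℕ.∸ j)) (p j (ℕP.<-≤-trans j≤i i<t)))
  ; ⊕-hom = λ f f′ i → trans (Σ<-cong (suc i) (λ j _ → ℤP.*-distribʳ-+ (g (i ℕ.∸ j)) (f j) (f′ j))) (Σ<-+ (suc i) _ _)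
  ; •-hom = λ c f i → trans (Σ<-cong (suc i) (λ j _ → ℤP.*-assoc c (f j) _)) (Σ<-* (suc i) c _)
  ; q-comm = q-comm′ }
  where
  q-comm′ : ∀ f → (q· f) ⊛ g ≈ q· (f ⊛ g)
  q-comm′ f zero = refl
  q-comm′ f (suc i) = trans (Σ<-front (suc i) _) (ℤP.+-identityˡ _)

⊛-comm : ∀ f g → f ⊛ g ≈ g ⊛ f
⊛-comm f g i = trans (Σ<-reverse (suc i) _)
  (Σ<-cong (suc i) (λ j j≤i → trans (cong (λ z → f (i ℕ.∸ j) * g z) (ℕP.m∸[m∸n]≡n (ℕP.≤-pred j≤i)))
                                      (ℤP.*-comm (f (i ℕ.∸ j)) (g j))))

⊛-linearʳ : ∀ f → IsQLinear (f ⊛_)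
⊛-linearʳ f = record
  { cong-≈ = λ {g} {g′} p → ≈-trans (⊛-comm f g) (≈-trans (cong-≈ (⊛-linearˡ f) p) (⊛-comm g′ f))
  ; cong-≈[] = λ {g} {g′} t p →
      ≈[]-trans (≈⇒≈[] (⊛-comm f g)) (≈[]-trans (cong-≈[] (⊛-linearˡ f) t p) (≈⇒≈[] (⊛-comm g′ f)))
  ; ⊕-hom = λ g g′ →
      ≈-trans (⊛-comm f (g ⊕ g′)) (≈-trans (⊕-hom (⊛-linearˡ f) g g′) (⊕-cong (⊛-comm g f) (⊛-comm g′ f)))
  ; •-hom = λ c g →
      ≈-trans (⊛-comm f (c • g)) (≈-trans (•-hom (⊛-linearˡ f) c g) (cong-≈ (•-linear c) (⊛-comm g f)))
  ; q-comm = λ g → ≈-trans (⊛-comm f (q· g)) (≈-trans (q-comm (⊛-linearˡ f) g) (cong-≈ q-linear (⊛-comm g f))) }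

1ₛ-⊛ : ∀ g → 1ₛ ⊛ g ≈ g
1ₛ-⊛ g i = trans (Σ<-front i (λ j → 1ₛ j * g (i ℕ.∸ j)))
  (trans (cong₂ _+_ (ℤP.*-identityˡ (g i)) (Σ<-zero i _ (λ j → ℤP.*-zeroˡ (g (i ℕ.∸ suc j))))) (ℤP.+-identityʳ (g i)))

-- qD f = q f′, the Euler derivative
qD : Series → Series
qD f i = + i * f i

qD-cong : ∀ {f g} → f ≈ g → qD f ≈ qD g
qD-cong p i = cong (+ i *_) (p i)

qD-q^ : ∀ a f → qD (q^ a · f) ≈ q^ a · qD f ⊕ + a • q^ a · f
qD-q^ a f i with shiftView a i
... | below i<a = begin
  + i * (q^ a · f) i                          ≡⟨ cong (+ i *_) (q^-below a f i<a) ⟩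
  + i * + 0                                   ≡⟨ ℤP.*-zeroʳ (+ i) ⟩
  + 0                                         ≡⟨ absorb (+ a) ⟩
  + 0 + + a * + 0                             ≡⟨ cong₂ (λ x y → x + + a * y) (q^-below a (qD f) i<a) (q^-below a f i<a) ⟨
  (q^ a · qD f) i + + a * (q^ a · f) i        ∎
  where
  open ≡-Reasoning
  absorb : ∀ a → + 0 ≡ + 0 + a * + 0
  absorb = solve-∀
... | above j = begin
  + (a ℕ.+ j) * (q^ a · f) (a ℕ.+ j)          ≡⟨ cong (+ (a ℕ.+ j) *_) (q^-above a f j) ⟩
  + (a ℕ.+ j) * f j                           ≡⟨ cong (_* f j) (ℤP.pos-+ a j) ⟩
  (+ a + + j) * f j                           ≡⟨ distrib (+ a) (+ j) (f j) ⟩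
  + j * f j + + a * f j                       ≡⟨ cong₂ (λ x y → x + + a * y) (q^-above a (qD f) j) (q^-above a f j) ⟨
  (q^ a · qD f) (a ℕ.+ j) + + a * (q^ a · f) (a ℕ.+ j) ∎
  where
  open ≡-Reasoning
  distrib : ∀ a j x → (a + j) * x ≡ j * x + a * x
  distrib = solve-∀

qD-[1-q^] : ∀ a f → qD ([1-q^ a ] f) ≈ [1-q^ a ] qD f ⊝ + a • q^ a · f
qD-[1-q^] a f i = begin
  + i * (f i - (q^ a · f) i)                      ≡⟨ distrib (+ i) (f i) _ ⟩
  + i * f i - + i * (q^ a · f) i                  ≡⟨ cong (_-_ (+ i * f i)) (qD-q^ a f i) ⟩
  + i * f i - ((q^ a · qD f) i + + a * (q^ a · f) i) ≡⟨ regroup (+ i * f i) _ _ ⟩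
  (+ i * f i - (q^ a · qD f) i) - + a * (q^ a · f) i ∎
  where
  open ≡-Reasoning
  distrib : ∀ i x y → i * (x - y) ≡ i * x - i * y
  distrib = solve-∀
  regroup : ∀ x y z → x - (y + z) ≡ (x - y) - z
  regroup = solve-∀

-- ℓ a = Σ_{j ≥ 1} a q^{a j} = a q^a / (1 - q^a) = - q (log (1 - q^a))′
ℓ : ℕ → Series
ℓ a zero = + 0
ℓ a (suc i) = if ⌊ a ∣? suc i ⌋ then + a else + 0

ℓ-∣ : ∀ a i → a ∣ suc i → ℓ a (suc i) ≡ + a
ℓ-∣ a i a∣ with a ∣? suc i
... | yes _ = refl
... | no a∤ = ⊥-elim (a∤ a∣)

ℓ-∤ : ∀ a i → ¬ a ∣ suc i → ℓ a (suc i) ≡ + 0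
ℓ-∤ a i a∤ with a ∣? suc i
... | yes a∣ = ⊥-elim (a∤ a∣)
... | no _ = refl

ℓ-below : ∀ a {i} → i ℕ.< a → ℓ a i ≡ + 0
ℓ-below a {zero} _ = refl
ℓ-below a {suc i} i<a = ℓ-∤ a i (λ a∣ → ℕP.<⇒≱ i<a (∣⇒≤ a∣))

ℓ-shift : ∀ a j → ℓ (suc a) (suc a ℕ.+ j) - ℓ (suc a) j ≡ + suc a * 1ₛ j
ℓ-shift a zero rewrite ℕP.+-identityʳ a =
  trans (cong (_- + 0) (ℓ-∣ (suc a) a ∣-refl)) (trans (ℤP.+-identityʳ (+ suc a)) (sym (ℤP.*-identityʳ (+ suc a))))
ℓ-shift a (suc j) = by-divisibility (suc a ∣? suc j)
  where
  by-divisibility : Dec (suc a ∣ suc j) → ℓ (suc a) (suc a ℕ.+ suc j) - ℓ (suc a) (suc j) ≡ + suc a * + 0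
  by-divisibility (yes a∣) = trans (cong₂ _-_ (ℓ-∣ (suc a) (a ℕ.+ suc j) (∣m∣n⇒∣m+n ∣-refl a∣)) (ℓ-∣ (suc a) j a∣))
                                   (trans (ℤP.+-inverseʳ (+ suc a)) (sym (ℤP.*-zeroʳ (+ suc a))))
  by-divisibility (no a∤) = trans (cong₂ _-_ (ℓ-∤ (suc a) (a ℕ.+ suc j) (λ a∣ → a∤ (∣m+n∣m⇒∣n a∣ ∣-refl)))
                                              (ℓ-∤ (suc a) j a∤))
                                  (sym (ℤP.*-zeroʳ (+ suc a)))

[1-q^]-ℓ : ∀ a → 1 ℕ.≤ a → [1-q^ a ] ℓ a ≈ + a • q^ a · 1ₛ
[1-q^]-ℓ (suc a) _ i with shiftView (suc a) i
... | below i<a = trans (cong₂ _-_ (ℓ-below (suc a) i<a) (q^-below (suc a) (ℓ (suc a)) i<a))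
                        (sym (trans (cong (+ suc a *_) (q^-below (suc a) 1ₛ i<a)) (ℤP.*-zeroʳ (+ suc a))))
... | above j = trans (cong (_-_ (ℓ (suc a) (suc a ℕ.+ j))) (q^-above (suc a) (ℓ (suc a)) j))
                      (trans (ℓ-shift a j) (cong (+ suc a *_) (sym (q^-above (suc a) 1ₛ j))))

-- L = - q A′ / A
NegLogDerivative : Series → Series → Set
NegLogDerivative A L = qD A ⊕ A ⊛ L ≈ 0ₛ

negLogDerivative-1ₛ : NegLogDerivative 1ₛ 0ₛ
negLogDerivative-1ₛ zero = refl
negLogDerivative-1ₛ (suc i) = trans (cong₂ _+_ (ℤP.*-zeroʳ (+ suc i)) (1ₛ-⊛ 0ₛ (suc i))) refl

negLogDerivative-cong : ∀ {A A′ L L′} → A ≈ A′ → L ≈ L′ → NegLogDerivative A L → NegLogDerivative A′ L′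
negLogDerivative-cong {A} {A′} {L} {L′} A≈ L≈ h =
  ≈-trans (⊕-cong (qD-cong (≈-sym A≈))
                  (≈-trans (cong-≈ (⊛-linearʳ A′) (≈-sym L≈)) (cong-≈ (⊛-linearˡ L) (≈-sym A≈)))) h

-- The derivative of 1 - q^a contributes - a q^a A, which (1 - q^a) A ⊛ ℓ a = a q^a A cancels.
negLogDerivative-[1-q^] : ∀ a {A L} → 1 ℕ.≤ a → NegLogDerivative A L → NegLogDerivative ([1-q^ a ] A) (L ⊕ ℓ a)
negLogDerivative-[1-q^] a {A} {L} 1≤a h i = begin
  qD ([1-q^ a ] A) i + ([1-q^ a ] A ⊛ (L ⊕ ℓ a)) i
    ≡⟨ cong₂ _+_ (qD-[1-q^] a A i) (trans (⊕-hom (⊛-linearʳ ([1-q^ a ] A)) L (ℓ a) i)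
                                         (cong₂ _+_ ([1-q^]-comm (⊛-linearˡ L) a A i) ℓ-term)) ⟩
  (([1-q^ a ] qD A) i - + a * (q^ a · A) i) + (([1-q^ a ] (A ⊛ L)) i + + a * (q^ a · A) i)
    ≡⟨ cancel (([1-q^ a ] qD A) i) _ _ ⟩
  ([1-q^ a ] qD A) i + ([1-q^ a ] (A ⊛ L)) i
    ≡⟨ ⊕-hom ([1-q^]-linear a) (qD A) (A ⊛ L) i ⟨
  ([1-q^ a ] (qD A ⊕ A ⊛ L)) i
    ≡⟨ ≈0-hom ([1-q^]-linear a) h i ⟩
  + 0 ∎
  where
  open ≡-Reasoning
  cancel : ∀ x y z → (x - y) + (z + y) ≡ x + z
  cancel = solve-∀
  ℓ-term : ([1-q^ a ] A ⊛ ℓ a) i ≡ + a * (q^ a · A) i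
  ℓ-term = begin
    ([1-q^ a ] A ⊛ ℓ a) i        ≡⟨ ⊛-comm ([1-q^ a ] A) (ℓ a) i ⟩
    (ℓ a ⊛ [1-q^ a ] A) i        ≡⟨ [1-q^]-comm (⊛-linearʳ (ℓ a)) a A i ⟩
    ([1-q^ a ] (ℓ a ⊛ A)) i      ≡⟨ [1-q^]-comm (⊛-linearˡ A) a (ℓ a) i ⟨
    ([1-q^ a ] ℓ a ⊛ A) i        ≡⟨ cong-≈ (⊛-linearˡ A) ([1-q^]-ℓ a 1≤a) i ⟩
    ((+ a • q^ a · 1ₛ) ⊛ A) i    ≡⟨ •q^-comm (⊛-linearˡ A) (+ a) a 1ₛ i ⟩
    + a * (q^ a · (1ₛ ⊛ A)) i    ≡⟨ cong (+ a *_) (cong-≈ (q^-linear a) (1ₛ-⊛ A) i) ⟩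
    + a * (q^ a · A) i           ∎

ℕ-from-doubled : ∀ {x y} → + 2 * + x ≡ + 2 * + y → x ≡ y
ℕ-from-doubled {x} {y} p = ℤP.+-injective (ℤP.*-cancelˡ-≡ (+ 2) (+ x) (+ y) p)

x≤m*x : ∀ {m} → 1 ℕ.≤ m → ∀ x → x ℕ.≤ m ℕ.* x
x≤m*x {m} 1≤m x = subst (ℕ._≤ m ℕ.* x) (ℕP.*-identityˡ x) (ℕP.*-monoˡ-≤ x 1≤m)

indicator : Bool → ℤ
indicator b = if b then + 1 else + 0

q^-1ₛ : ∀ s t → (q^ s · 1ₛ) t ≡ indicator (s ℕ.≡ᵇ t)
q^-1ₛ zero zero = refl
q^-1ₛ zero (suc t) = refl
q^-1ₛ (suc s) zero = refl
q^-1ₛ (suc s) (suc t) = q^-1ₛ s t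

≡ᵇ-true : ∀ {a c} → (a ℕ.≡ᵇ c) ≡ true → a ≡ c
≡ᵇ-true {a} {c} eq = ℕP.≡ᵇ⇒≡ a c (subst T (sym eq) _)

module _ {f : ℕ → ℕ} (f-step : ∀ x → f x ℕ.< f (suc x)) where

  increasing-< : ∀ {x y} → x ℕ.< y → f x ℕ.< f y
  increasing-< {x} {suc y} (s≤s x≤y) with ℕP.m≤n⇒m<n∨m≡n x≤y
  ... | inj₁ x<y = ℕP.<-trans (increasing-< x<y) (f-step y)
  ... | inj₂ refl = f-step x

  increasing-≤ : ∀ {x y} → x ℕ.≤ y → f x ℕ.≤ f y
  increasing-≤ x≤y with ℕP.m≤n⇒m<n∨m≡n x≤y
  ... | inj₁ x<y = ℕP.<⇒≤ (increasing-< x<y)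
  ... | inj₂ refl = ℕP.≤-refl

  increasing-injective : ∀ {x y} → f x ≡ f y → x ≡ y
  increasing-injective {x} {y} eq with ℕP.<-cmp x y
  ... | tri< x<y _ _ = ⊥-elim (ℕP.<-irrefl eq (increasing-< x<y))
  ... | tri≈ _ x≡y _ = x≡y
  ... | tri> _ _ y<x = ⊥-elim (ℕP.<-irrefl (sym eq) (increasing-< y<x))

only-third : ∀ {x y z w v} → x ≡ + 0 → y ≡ + 0 → z ≡ v → w ≡ + 0 → x + y + z + w ≡ v
only-third refl refl refl refl = trans (ℤP.+-identityʳ _) (ℤP.+-identityˡ _)

only-fourth : ∀ {x y z w v} → x ≡ + 0 → y ≡ + 0 → z ≡ + 0 → w ≡ v → x + y + z + w ≡ v
only-fourth refl refl refl refl = ℤP.+-identityˡ _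

sgn-suc : ∀ k → sgn (suc k) ≡ - sgn k
sgn-suc zero = refl
sgn-suc (suc zero) = refl
sgn-suc (suc (suc k)) = sgn-suc k

sign : ℤ → ℤ
sign (+ k) = sgn k
sign -[1+ j ] = sgn (suc j)

sign-pred : ∀ k → sign (k - + 1) ≡ - sign k
sign-pred (+ zero) = refl
sign-pred (+ suc j) = trans (sym (ℤP.neg-involutive (sgn j))) (cong -_ (sym (sgn-suc j)))
sign-pred -[1+ j ] rewrite ℕP.+-identityʳ j = sgn-suc (suc j)

sign-suc : ∀ k → sign (k + + 1) ≡ - sign k
sign-suc k = trans (sym (ℤP.neg-involutive _)) (cong -_ (trans (sym (sign-pred (k + + 1))) (cong sign (cancel k))))
  where
  cancel : ∀ x → (x + + 1) - + 1 ≡ x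
  cancel = solve-∀

sum-filter-singleton : ∀ (B : ℕ → Bool) x → sum (filter (λ d → T? (B d)) (x ∷ [])) ≡ (if B x then x else 0)
sum-filter-singleton B x with B x
... | true = ℕP.+-identityʳ x
... | false = refl

module Gaussian (m : ℕ) where

  poch : ℕ → Series → Series
  poch zero f = f
  poch (suc a) f = poch a ([1-q^ m ℕ.* suc a ] f)

  poch-linear : ∀ a → IsQLinear (poch a)
  poch-linear zero = id-linear
  poch-linear (suc a) = ∘-linear (poch-linear a) ([1-q^]-linear (m ℕ.* suc a))

  poch-comm : ∀ a b f → poch a (poch b f) ≈ poch b (poch a f)
  poch-comm a zero f = ≈-refl
  poch-comm a (suc b) f =
    ≈-trans (poch-comm a b _) (cong-≈ (poch-linear b) ([1-q^]-comm (poch-linear a) (m ℕ.* suc b) f))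

  -- gauss a b is the Gaussian binomial coefficient [a + b, a] in base q^m,
  -- defined by one of its two q-Pascal rules.
  gauss : ℕ → ℕ → Series
  gauss zero b = 1ₛ
  gauss (suc a) zero = 1ₛ
  gauss (suc a) (suc b) = gauss a (suc b) ⊕ q^ m ℕ.* suc a · gauss (suc a) b

  poch-gauss : ∀ a b → poch a (poch b (gauss a b)) ≈ poch (a ℕ.+ b) 1ₛ
  poch-gauss zero b = ≈-refl
  poch-gauss (suc a) zero rewrite ℕP.+-identityʳ a = ≈-refl
  poch-gauss (suc a) (suc b) = begin
    pp (gauss a (suc b) ⊕ q^ c · gauss (suc a) b)        ≈⟨ ⊕-hom pp-linear (gauss a (suc b)) (q^ c · gauss (suc a) b) ⟩
    pp (gauss a (suc b)) ⊕ pp (q^ c · gauss (suc a) b)   ≈⟨ (λ i → cong₂ _+_ (left i) (right i)) ⟩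
    [1-q^ c ] W ⊕ q^ c · [1-q^ d ] W                     ≈⟨ [1-q^]-+ c d W ⟩
    [1-q^ c ℕ.+ d ] W                                    ≈⟨ (λ i → cong (λ k → ([1-q^ k ] W) i) c+d) ⟨
    [1-q^ m ℕ.* suc (suc (a ℕ.+ b)) ] W
      ≈⟨ [1-q^]-comm (poch-linear (suc (a ℕ.+ b))) (m ℕ.* suc (suc (a ℕ.+ b))) 1ₛ ⟨
    poch (suc (suc (a ℕ.+ b))) 1ₛ                        ≈⟨ (λ i → cong (λ k → poch (suc k) 1ₛ i) (ℕP.+-suc a b)) ⟨
    poch (suc a ℕ.+ suc b) 1ₛ                            ∎
    where
    open ≈-Reasoning
    c = m ℕ.* suc a
    d = m ℕ.* suc b
    W = poch (suc (a ℕ.+ b)) 1ₛ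
    pp = λ f → poch (suc a) (poch (suc b) f)
    pp-linear = ∘-linear (poch-linear (suc a)) (poch-linear (suc b))
    c+d : m ℕ.* suc (suc (a ℕ.+ b)) ≡ c ℕ.+ d
    c+d = trans (cong (λ k → m ℕ.* suc k) (sym (ℕP.+-suc a b))) (ℕP.*-distribˡ-+ m (suc a) (suc b))
    left : pp (gauss a (suc b)) ≈ [1-q^ c ] W
    left = ≈-trans ([1-q^]-comm (poch-linear a) c (poch (suc b) (gauss a (suc b))))
             (cong-≈ ([1-q^]-linear c) (≈-trans (poch-gauss a (suc b))
               (λ i → cong (λ k → poch k 1ₛ i) (ℕP.+-suc a b))))
    right : pp (q^ c · gauss (suc a) b) ≈ q^ c · [1-q^ d ] W
    right = ≈-trans (cong-≈ (poch-linear (suc a)) (q^-comm (poch-linear (suc b)) c (gauss (suc a) b)))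
              (≈-trans (q^-comm (poch-linear (suc a)) c (poch (suc b) (gauss (suc a) b)))
                (cong-≈ (q^-linear c)
                  (≈-trans (cong-≈ (poch-linear (suc a)) ([1-q^]-comm (poch-linear b) d (gauss (suc a) b)))
                    (≈-trans ([1-q^]-comm (poch-linear (suc a)) d (poch b (gauss (suc a) b)))
                      (cong-≈ ([1-q^]-linear d) (poch-gauss (suc a) b))))))

  poch-≈[] : ∀ c d f → poch (c ℕ.+ d) f ≈[ m ℕ.* suc c ] poch c f
  poch-≈[] c zero f rewrite ℕP.+-identityʳ c = ≈[]-refl
  poch-≈[] c (suc d) f rewrite ℕP.+-suc c d =
    ≈[]-trans (cong-≈[] (poch-linear (c ℕ.+ d)) (m ℕ.* suc c)
                ([1-q^]-below (m ℕ.* suc (c ℕ.+ d)) (m ℕ.* suc c) f (ℕP.*-monoʳ-≤ m (s≤s (ℕP.m≤m+n c d)))))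
              (poch-≈[] c d f)

  poch-≈[]-≤ : ∀ c j f → c ℕ.≤ j → poch j f ≈[ m ℕ.* suc c ] poch c f
  poch-≈[]-≤ c j f c≤j with ℕP.m≤n⇒∃[o]m+o≡n c≤j
  ... | d , refl = poch-≈[] c d f

  gaussℤ : ℤ → ℤ → Series
  gaussℤ (+ a) (+ b) = gauss a b
  gaussℤ (+ a) -[1+ _ ] = 0ₛ
  gaussℤ -[1+ _ ] _ = 0ₛ

  gaussℤ-neg : ∀ A j → gaussℤ A -[1+ j ] ≡ 0ₛ
  gaussℤ-neg (+ a) j = refl
  gaussℤ-neg -[1+ i ] j = refl

  gaussℤ-cong : ∀ {A A′ B B′} → A ≡ A′ → B ≡ B′ → gaussℤ A B ≈ gaussℤ A′ B′
  gaussℤ-cong refl refl = ≈-refl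

  module Positive (1≤m : 1 ℕ.≤ m) where

    poch-cancel-≈[] : ∀ a t {f g} → poch a f ≈[ t ] poch a g → f ≈[ t ] g
    poch-cancel-≈[] zero t p = p
    poch-cancel-≈[] (suc a) t p =
      [1-q^]-cancel (m ℕ.* suc a) t (ℕP.*-mono-≤ 1≤m (s≤s z≤n)) (poch-cancel-≈[] a t p)

    poch-cancel : ∀ a {f g} → poch a f ≈ poch a g → f ≈ g
    poch-cancel a p i = poch-cancel-≈[] a (suc i) (≈⇒≈[] p) i (ℕP.n<1+n i)

    gauss-sym : ∀ a b → gauss a b ≈ gauss b a
    gauss-sym a b = poch-cancel b (poch-cancel a (begin
      poch a (poch b (gauss a b))   ≈⟨ poch-gauss a b ⟩
      poch (a ℕ.+ b) 1ₛ             ≈⟨ (λ i → cong (λ k → poch k 1ₛ i) (ℕP.+-comm a b)) ⟩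
      poch (b ℕ.+ a) 1ₛ             ≈⟨ poch-gauss b a ⟨
      poch b (poch a (gauss b a))   ≈⟨ poch-comm b a _ ⟩
      poch a (poch b (gauss b a))   ∎))
      where open ≈-Reasoning

    gauss-pascal : ∀ a b → gauss (suc a) (suc b) ≈ gauss (suc a) b ⊕ q^ m ℕ.* suc b · gauss a (suc b)
    gauss-pascal a b i = begin
      gauss (suc a) (suc b) i
        ≡⟨ gauss-sym (suc a) (suc b) i ⟩
      gauss b (suc a) i + (q^ m ℕ.* suc b · gauss (suc b) a) i
        ≡⟨ cong₂ _+_ (gauss-sym b (suc a) i) (cong-≈ (q^-linear (m ℕ.* suc b)) (gauss-sym (suc b) a) i) ⟩
      gauss (suc a) b i + (q^ m ℕ.* suc b · gauss a (suc b)) i ∎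
      where open ≡-Reasoning

    q^·0 : ∀ x {i} → (q^ m ℕ.* ℤ.∣ x ∣ · 0ₛ) i ≡ + 0
    q^·0 x {i} = 0-hom (q^-linear (m ℕ.* ℤ.∣ x ∣)) i

    q^0·gauss0 : ∀ a {i} → (q^ m ℕ.* 0 · gauss a 0) i ≡ 1ₛ i
    q^0·gauss0 a {i} rewrite ℕP.*-zeroʳ m = gauss-zero a i
      where
      gauss-zero : ∀ a → gauss a 0 ≈ 1ₛ
      gauss-zero zero = ≈-refl
      gauss-zero (suc a) = ≈-refl

    pascal-right : ∀ a b → gauss a (suc b) ≈ gauss a b ⊕ q^ m ℕ.* suc b · gaussℤ (+ a - + 1) (+ suc b)
    pascal-right zero b i = sym (trans (cong (_+_ (1ₛ i)) (0-hom (q^-linear (m ℕ.* suc b)) i)) (ℤP.+-identityʳ (1ₛ i)))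
    pascal-right (suc a) b = gauss-pascal a b

    pascal-left : ∀ a b → gauss (suc a) b ≈ q^ m ℕ.* b · gauss a b ⊕ gaussℤ (+ suc a) (+ b - + 1)
    pascal-left a zero i = sym (trans (ℤP.+-identityʳ _) (q^0·gauss0 a))
    pascal-left a (suc b) i = trans (gauss-pascal a b i) (ℤP.+-comm (gauss (suc a) b i) _)

    gauss-three-term : ∀ a b → gauss (suc a) (suc b) ≈
      gauss a b ⊕ q^ m ℕ.* suc (a ℕ.+ b) · gauss a b
        ⊕ q^ m ℕ.* suc b · gaussℤ (+ a - + 1) (+ suc b) ⊕ q^ m ℕ.* suc a · gaussℤ (+ suc a) (+ b - + 1)
    gauss-three-term a b i = begin
      gauss a (suc b) i + (q^ c · gauss (suc a) b) i
        ≡⟨ cong₂ _+_ (pascal-right a b i) (trans (cong-≈ (q^-linear c) (pascal-left a b) i) (⊕-hom (q^-linear c) _ _ i)) ⟩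
      (gauss a b i + x) + ((q^ c · q^ m ℕ.* b · gauss a b) i + y)
        ≡⟨ cong (λ z → (gauss a b i + x) + (z + y))
             (trans (cong (λ e → (q^ e · gauss a b) i) c+mb) (q^-+ c (m ℕ.* b) (gauss a b) i)) ⟨
      (gauss a b i + x) + ((q^ m ℕ.* suc (a ℕ.+ b) · gauss a b) i + y)
        ≡⟨ regroup (gauss a b i) x _ y ⟩
      ((gauss a b i + (q^ m ℕ.* suc (a ℕ.+ b) · gauss a b) i) + x) + y ∎
      where
      open ≡-Reasoning
      c = m ℕ.* suc a
      x = (q^ m ℕ.* suc b · gaussℤ (+ a - + 1) (+ suc b)) i
      y = (q^ c · gaussℤ (+ suc a) (+ b - + 1)) i
      c+mb : m ℕ.* suc (a ℕ.+ b) ≡ c ℕ.+ m ℕ.* b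
      c+mb = ℕP.*-distribˡ-+ m (suc a) b
      regroup : ∀ x y z w → (x + y) + (z + w) ≡ ((x + z) + y) + w
      regroup = solve-∀

    -- Each ℤ.∣_∣ is harmless: when the integer inside is negative, the series it shifts is 0.
    gaussℤ-three-term : ∀ A B n → A + B ≡ + n →
      gaussℤ (A + + 1) (B + + 1) ≈
        gaussℤ A B ⊕ q^ m ℕ.* ℤ.∣ A + B + + 1 ∣ · gaussℤ A B
          ⊕ q^ m ℕ.* ℤ.∣ B + + 1 ∣ · gaussℤ (A - + 1) (B + + 1)
          ⊕ q^ m ℕ.* ℤ.∣ A + + 1 ∣ · gaussℤ (A + + 1) (B - + 1)
    gaussℤ-three-term (+ a) (+ b) n _ rewrite ℕP.+-comm a 1 | ℕP.+-comm b 1 | ℕP.+-comm (a ℕ.+ b) 1 =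
      gauss-three-term a b
    gaussℤ-three-term (+ zero) -[1+ zero ] n ()
    gaussℤ-three-term (+ suc a) -[1+ zero ] n _ i =
      sym (only-third refl (q^·0 (+ suc a + -[1+ 0 ] + + 1)) (q^0·gauss0 a) (q^·0 (+ suc a + + 1)))
    gaussℤ-three-term (+ a) -[1+ suc j ] n _ i =
      sym (only-third refl (q^·0 (+ a + -[1+ suc j ] + + 1))
            (trans (cong (λ f → (q^ m ℕ.* ℤ.∣ -[1+ j ] ∣ · f) i) (gaussℤ-neg (+ a - + 1) j)) (q^·0 -[1+ j ]))
            (q^·0 (+ a + + 1)))
    gaussℤ-three-term -[1+ zero ] (+ zero) n ()
    gaussℤ-three-term -[1+ zero ] (+ suc b) n _ i =
      sym (only-fourth refl (q^·0 (-[1+ 0 ] + + suc b + + 1)) (q^·0 (+ suc b + + 1)) (q^0·gauss0 0))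
    gaussℤ-three-term -[1+ suc k ] (+ b) n _ i =
      sym (only-fourth refl (q^·0 (-[1+ suc k ] + + b + + 1)) (q^·0 (+ b + + 1)) (q^·0 -[1+ k ]))
    gaussℤ-three-term -[1+ k ] -[1+ j ] n ()

    -- (q^m;q^m)_a (q^m;q^m)_b [a + b, a] = (q^m;q^m)_{a+b}, and every (q^m;q^m)_j with j ≥ c
    -- is ≡ (q^m;q^m)_c modulo q^{m(c+1)}; cancel (q^m;q^m)_a (q^m;q^m)_b from both sides.
    poch-gauss-≈[] : ∀ N a b c → c ℕ.≤ a → c ℕ.≤ b → c ℕ.≤ N → poch N (gauss a b) ≈[ m ℕ.* suc c ] 1ₛ
    poch-gauss-≈[] N a b c c≤a c≤b c≤N =
      poch-cancel-≈[] b t (poch-cancel-≈[] a t (≈[]-trans lhs (≈[]-sym rhs)))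
      where
      t = m ℕ.* suc c
      lhs : poch a (poch b (poch N (gauss a b))) ≈[ t ] poch c (poch c 1ₛ)
      lhs = ≈[]-trans
              (≈⇒≈[] (≈-trans (cong-≈ (poch-linear a) (poch-comm b N _))
                (≈-trans (poch-comm a N _) (cong-≈ (poch-linear N) (poch-gauss a b)))))
              (≈[]-trans (poch-≈[]-≤ c N _ c≤N)
                (cong-≈[] (poch-linear c) t (poch-≈[]-≤ c (a ℕ.+ b) 1ₛ (ℕP.≤-trans c≤a (ℕP.m≤m+n a b)))))
      rhs : poch a (poch b 1ₛ) ≈[ t ] poch c (poch c 1ₛ)
      rhs = ≈[]-trans (poch-≈[]-≤ c a _ c≤a) (cong-≈[] (poch-linear c) t (poch-≈[]-≤ c b 1ₛ c≤b))

module Polygonal (m : ℕ) (1≤m : 1 ℕ.≤ m) where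

  M : ℤ
  M = + m

  -- P′ k = P_{m+2,k} and Q′ k = Q_{m+2,k}, given by their first differences
  P′ : ℕ → ℕ
  P′ zero = 0
  P′ (suc k) = P′ k ℕ.+ (m ℕ.* k ℕ.+ 1)

  Q′ : ℕ → ℕ
  Q′ zero = 0
  Q′ (suc k) = Q′ k ℕ.+ (m ℕ.* k ℕ.+ (m ℕ.∸ 1))

  polygonal : ℤ → ℕ
  polygonal (+ k) = P′ k
  polygonal -[1+ j ] = Q′ (suc j)

  +[m*x+y] : ∀ x y → + (m ℕ.* x ℕ.+ y) ≡ M * + x + + y
  +[m*x+y] x y = trans (ℤP.pos-+ (m ℕ.* x) y) (cong (_+ + y) (ℤP.pos-* m x))

  +[m∸1] : + (m ℕ.∸ 1) ≡ M - + 1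
  +[m∸1] = trans (sym (ℤP.⊖-≥ 1≤m)) (sym (ℤP.m-n≡m⊖n m 1))

  double-step : ∀ p d → + 2 * + (p ℕ.+ d) ≡ + 2 * + p + + 2 * + d
  double-step p d = trans (cong (+ 2 *_) (ℤP.pos-+ p d)) (ℤP.*-distribˡ-+ (+ 2) (+ p) (+ d))

  double-P′ : ∀ j → + 2 * + P′ j ≡ M * + j * + j - (M - + 2) * + j
  double-P′ zero = vanish M
    where
    vanish : ∀ M → + 0 ≡ M * + 0 * + 0 - (M - + 2) * + 0
    vanish = solve-∀
  double-P′ (suc j) = begin
    + 2 * + (P′ j ℕ.+ (m ℕ.* j ℕ.+ 1))             ≡⟨ double-step (P′ j) _ ⟩
    + 2 * + P′ j + + 2 * + (m ℕ.* j ℕ.+ 1)         ≡⟨ cong₂ (λ u v → u + + 2 * v) (double-P′ j) (+[m*x+y] j 1) ⟩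
    (M * + j * + j - (M - + 2) * + j) + + 2 * (M * + j + + 1)
                                                    ≡⟨ step M (+ j) ⟩
    M * (+ 1 + + j) * (+ 1 + + j) - (M - + 2) * (+ 1 + + j) ∎
    where
    open ≡-Reasoning
    step : ∀ M J → (M * J * J - (M - + 2) * J) + + 2 * (M * J + + 1) ≡ M * (+ 1 + J) * (+ 1 + J) - (M - + 2) * (+ 1 + J)
    step = solve-∀

  double-Q′ : ∀ j → + 2 * + Q′ j ≡ M * + j * + j + (M - + 2) * + j
  double-Q′ zero = vanish M
    where
    vanish : ∀ M → + 0 ≡ M * + 0 * + 0 + (M - + 2) * + 0
    vanish = solve-∀
  double-Q′ (suc j) = begin
    + 2 * + (Q′ j ℕ.+ (m ℕ.* j ℕ.+ (m ℕ.∸ 1)))     ≡⟨ double-step (Q′ j) _ ⟩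
    + 2 * + Q′ j + + 2 * + (m ℕ.* j ℕ.+ (m ℕ.∸ 1)) ≡⟨ cong₂ (λ u v → u + + 2 * v) (double-Q′ j)
                                                         (trans (+[m*x+y] j (m ℕ.∸ 1)) (cong (_+_ (M * + j)) +[m∸1])) ⟩
    (M * + j * + j + (M - + 2) * + j) + + 2 * (M * + j + (M - + 1))
                                                    ≡⟨ step M (+ j) ⟩
    M * (+ 1 + + j) * (+ 1 + + j) + (M - + 2) * (+ 1 + + j) ∎
    where
    open ≡-Reasoning
    step : ∀ M J → (M * J * J + (M - + 2) * J) + + 2 * (M * J + (M - + 1)) ≡ M * (+ 1 + J) * (+ 1 + J) + (M - + 2) * (+ 1 + J)
    step = solve-∀

  double-polygonal : ∀ k → + 2 * + polygonal k ≡ M * k * k - (M - + 2) * k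
  double-polygonal (+ j) = double-P′ j
  double-polygonal -[1+ j ] = trans (double-Q′ (suc j)) (negate M (+ 1 + + j))
    where
    negate : ∀ M K → M * K * K + (M - + 2) * K ≡ M * (- K) * (- K) - (M - + 2) * (- K)
    negate = solve-∀

  private
    X : ℤ → ℤ
    X k = M * k * k - (M - + 2) * k

  polygonal-shift : ∀ a k′ k c → + 2 * + a + X k′ ≡ X k + + 2 * (M * + c) →
                    a ℕ.+ polygonal k′ ≡ polygonal k ℕ.+ m ℕ.* c
  polygonal-shift a k′ k c h = ℕ-from-doubled (begin
    + 2 * + (a ℕ.+ polygonal k′)              ≡⟨ double-step a _ ⟩
    + 2 * + a + + 2 * + polygonal k′          ≡⟨ cong (_+_ (+ 2 * + a)) (double-polygonal k′) ⟩
    + 2 * + a + X k′                          ≡⟨ h ⟩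
    X k + + 2 * (M * + c)                     ≡⟨ cong₂ (λ u v → u + + 2 * v) (double-polygonal k) (ℤP.pos-* m c) ⟨
    + 2 * + polygonal k + + 2 * + (m ℕ.* c)   ≡⟨ double-step (polygonal k) _ ⟨
    + 2 * + (polygonal k ℕ.+ m ℕ.* c)         ∎)
    where open ≡-Reasoning

  polygonal-down : ∀ N k c → + c ≡ + N - k + + 1 →
                   (m ℕ.* N ℕ.+ 1) ℕ.+ polygonal (k - + 1) ≡ polygonal k ℕ.+ m ℕ.* c
  polygonal-down N k c c≡ = polygonal-shift _ (k - + 1) k c (begin
    + 2 * + (m ℕ.* N ℕ.+ 1) + X (k - + 1)       ≡⟨ cong (λ u → + 2 * u + X (k - + 1)) (+[m*x+y] N 1) ⟩
    + 2 * (M * + N + + 1) + X (k - + 1)         ≡⟨ identity M (+ N) k ⟩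
    X k + + 2 * (M * (+ N - k + + 1))           ≡⟨ cong (λ c → X k + + 2 * (M * c)) c≡ ⟨
    X k + + 2 * (M * + c)                       ∎)
    where
    open ≡-Reasoning
    identity : ∀ M N k → + 2 * (M * N + + 1) + (M * (k - + 1) * (k - + 1) - (M - + 2) * (k - + 1))
                         ≡ (M * k * k - (M - + 2) * k) + + 2 * (M * (N - k + + 1))
    identity = solve-∀

  polygonal-up : ∀ N k c → + c ≡ + N + k + + 1 →
                 (m ℕ.* N ℕ.+ (m ℕ.∸ 1)) ℕ.+ polygonal (k + + 1) ≡ polygonal k ℕ.+ m ℕ.* c
  polygonal-up N k c c≡ = polygonal-shift _ (k + + 1) k c (begin
    + 2 * + (m ℕ.* N ℕ.+ (m ℕ.∸ 1)) + X (k + + 1)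
      ≡⟨ cong (λ u → + 2 * u + X (k + + 1)) (trans (+[m*x+y] N (m ℕ.∸ 1)) (cong (_+_ (M * + N)) +[m∸1])) ⟩
    + 2 * (M * + N + (M - + 1)) + X (k + + 1)   ≡⟨ identity M (+ N) k ⟩
    X k + + 2 * (M * (+ N + k + + 1))           ≡⟨ cong (λ c → X k + + 2 * (M * c)) c≡ ⟨
    X k + + 2 * (M * + c)                       ∎)
    where
    open ≡-Reasoning
    identity : ∀ M N k → + 2 * (M * N + (M - + 1)) + (M * (k + + 1) * (k + + 1) - (M - + 2) * (k + + 1))
                         ≡ (M * k * k - (M - + 2) * k) + + 2 * (M * (N + k + + 1))
    identity = solve-∀

module TripleProduct (m : ℕ) (1≤m : 1 ℕ.≤ m) where

  open Gaussian m
  open Positive 1≤m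
  open Polygonal m 1≤m

  α β : ℕ → ℕ
  α N = m ℕ.* N ℕ.+ 1
  β N = m ℕ.* N ℕ.+ (m ℕ.∸ 1)

  jacobiProduct : ℕ → Series → Series
  jacobiProduct zero f = f
  jacobiProduct (suc N) f = jacobiProduct N ([1-q^ α N ] [1-q^ β N ] f)

  jacobiProduct-linear : ∀ N → IsQLinear (jacobiProduct N)
  jacobiProduct-linear zero = id-linear
  jacobiProduct-linear (suc N) =
    ∘-linear (jacobiProduct-linear N) (∘-linear ([1-q^]-linear (α N)) ([1-q^]-linear (β N)))

  term : ℕ → ℤ → Series
  term N k = sign k • q^ polygonal k · gaussℤ (+ N + k) (+ N - k)

  jacobiSum : ℕ → Series
  jacobiSum N = Σₛ (- + N) (suc (N ℕ.+ N)) (term N)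

  q^-polygonal-down : ∀ N k X → (∀ j → + N - k + + 1 ≡ -[1+ j ] → X ≈ 0ₛ) →
    q^ α N · q^ polygonal (k - + 1) · X ≈ q^ polygonal k · q^ m ℕ.* ℤ.∣ + N - k + + 1 ∣ · X
  q^-polygonal-down N k X vanish with + N - k + + 1 in eq
  ... | + c = q^-exchange (α N) (polygonal (k - + 1)) (polygonal k) (m ℕ.* c) X (polygonal-down N k c (sym eq))
  ... | -[1+ j ] = q^q^-vanish (α N) (polygonal (k - + 1)) (polygonal k) (m ℕ.* suc j) (vanish j refl)

  q^-polygonal-up : ∀ N k X → (∀ j → + N + k + + 1 ≡ -[1+ j ] → X ≈ 0ₛ) →
    q^ β N · q^ polygonal (k + + 1) · X ≈ q^ polygonal k · q^ m ℕ.* ℤ.∣ + N + k + + 1 ∣ · X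
  q^-polygonal-up N k X vanish with + N + k + + 1 in eq
  ... | + c = q^-exchange (β N) (polygonal (k + + 1)) (polygonal k) (m ℕ.* c) X (polygonal-up N k c (sym eq))
  ... | -[1+ j ] = q^q^-vanish (β N) (polygonal (k + + 1)) (polygonal k) (m ℕ.* suc j) (vanish j refl)

  α+β : ∀ N → α N ℕ.+ β N ≡ m ℕ.* (N ℕ.+ N ℕ.+ 1)
  α+β N = subst (λ x → (x ℕ.* N ℕ.+ 1) ℕ.+ (x ℕ.* N ℕ.+ (m ℕ.∸ 1)) ≡ x ℕ.* (N ℕ.+ N ℕ.+ 1))
                (ℕP.m+[n∸m]≡n 1≤m) (identity (m ℕ.∸ 1) N)
    where
    identity : ∀ p N → (suc p ℕ.* N ℕ.+ 1) ℕ.+ (suc p ℕ.* N ℕ.+ p) ≡ suc p ℕ.* (N ℕ.+ N ℕ.+ 1)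
    identity = ℕSolver.solve-∀

  module _ (N : ℕ) (k : ℤ) where

    private
      A = + N + k
      B = + N - k

    term-diagonal : q^ polygonal k · q^ m ℕ.* ℤ.∣ A + B + + 1 ∣ · gaussℤ A B ≈
                    q^ α N ℕ.+ β N · q^ polygonal k · gaussℤ A B
    term-diagonal = q^-exchange (polygonal k) _ (α N ℕ.+ β N) (polygonal k) (gaussℤ A B)
      (trans (ℕP.+-comm (polygonal k) _) (cong (ℕ._+ polygonal k) (trans (cong (λ z → m ℕ.* ℤ.∣ z + + 1 ∣) (A+B (+ N) k))
                                                                         (sym (α+β N)))))
      where
      A+B : ∀ n k → (n + k) + (n - k) ≡ n + n
      A+B = solve-∀

    term-lower : q^ polygonal k · q^ m ℕ.* ℤ.∣ B + + 1 ∣ · gaussℤ (A - + 1) (B + + 1) ≈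
                 q^ α N · q^ polygonal (k - + 1) · gaussℤ (+ N + (k - + 1)) (+ N - (k - + 1))
    term-lower = ≈-sym (≈-trans
      (cong-≈ (∘-linear (q^-linear (α N)) (q^-linear (polygonal (k - + 1)))) (gaussℤ-cong (index₁ (+ N) k) (index₂ (+ N) k)))
      (q^-polygonal-down N k (gaussℤ (A - + 1) (B + + 1))
        (λ j eq i → trans (cong (λ b → gaussℤ (A - + 1) b i) eq) (cong (λ f → f i) (gaussℤ-neg (A - + 1) j)))))
      where
      index₁ : ∀ n k → n + (k - + 1) ≡ (n + k) - + 1
      index₁ = solve-∀
      index₂ : ∀ n k → n - (k - + 1) ≡ (n - k) + + 1
      index₂ = solve-∀

    term-upper : q^ polygonal k · q^ m ℕ.* ℤ.∣ A + + 1 ∣ · gaussℤ (A + + 1) (B - + 1) ≈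
                 q^ β N · q^ polygonal (k + + 1) · gaussℤ (+ N + (k + + 1)) (+ N - (k + + 1))
    term-upper = ≈-sym (≈-trans
      (cong-≈ (∘-linear (q^-linear (β N)) (q^-linear (polygonal (k + + 1)))) (gaussℤ-cong (index₁ (+ N) k) (index₂ (+ N) k)))
      (q^-polygonal-up N k (gaussℤ (A + + 1) (B - + 1)) (λ j eq i → cong (λ a → gaussℤ a (B - + 1) i) eq)))
      where
      index₁ : ∀ n k → n + (k + + 1) ≡ (n + k) + + 1
      index₁ = solve-∀
      index₂ : ∀ n k → n - (k + + 1) ≡ (n - k) - + 1
      index₂ = solve-∀

  -- The three-term recurrence of gaussℤ, multiplied by (-1)^k q^{polygonal k}: the polygonal
  -- exponents absorb the shifts, and the signs of the neighbours k ∓ 1 are opposite.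
  term-suc : ∀ N k → term (suc N) k ≈
    term N k ⊕ q^ α N ℕ.+ β N · term N k ⊝ q^ α N · term N (k - + 1) ⊝ q^ β N · term N (k + + 1)
  term-suc N k i = begin
    s * (q^ E · gaussℤ (+ suc N + k) (+ suc N - k)) i
      ≡⟨ cong (s *_) (cong-≈ (q^-linear E) (gaussℤ-cong (shift-A (+ N) k) (shift-B (+ N) k)) i) ⟩
    s * (q^ E · gaussℤ (A + + 1) (B + + 1)) i
      ≡⟨ cong (s *_) (cong-≈ (q^-linear E) (gaussℤ-three-term A B (N ℕ.+ N) (A+B (+ N) k)) i) ⟩
    s * (q^ E · (G ⊕ Y ⊕ Z ⊕ W)) i
      ≡⟨ cong (s *_) (distribute i) ⟩
    s * ((q^ E · G) i + (q^ E · Y) i + (q^ E · Z) i + (q^ E · W) i)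
      ≡⟨ cong₃ (λ x y z → s * ((q^ E · G) i + x + y + z)) (term-diagonal N k i) (term-lower N k i) (term-upper N k i) ⟩
    s * ((q^ E · G) i + (q^ α N ℕ.+ β N · q^ E · G) i + (q^ α N · Z′) i + (q^ β N · W′) i)
      ≡⟨ rearrange s _ _ _ _ ⟩
    s * (q^ E · G) i + s * (q^ α N ℕ.+ β N · q^ E · G) i - (- s) * (q^ α N · Z′) i - (- s) * (q^ β N · W′) i
      ≡⟨ cong₂ (λ x y → s * (q^ E · G) i + s * (q^ α N ℕ.+ β N · q^ E · G) i - x * (q^ α N · Z′) i - y * (q^ β N · W′) i)
           (sign-pred k) (sign-suc k) ⟨
    s * (q^ E · G) i + s * (q^ α N ℕ.+ β N · q^ E · G) i
      - sign (k - + 1) * (q^ α N · Z′) i - sign (k + + 1) * (q^ β N · W′) i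
      ≡⟨ cong₃ (λ x y z → s * (q^ E · G) i + x - y - z)
           (•-hom (q^-linear (α N ℕ.+ β N)) s (q^ E · G) i) (•-hom (q^-linear (α N)) (sign (k - + 1)) Z′ i)
           (•-hom (q^-linear (β N)) (sign (k + + 1)) W′ i) ⟨
    term N k i + (q^ α N ℕ.+ β N · term N k) i - (q^ α N · term N (k - + 1)) i - (q^ β N · term N (k + + 1)) i ∎
    where
    open ≡-Reasoning
    s = sign k
    E = polygonal k
    A = + N + k
    B = + N - k
    G = gaussℤ A B
    Y = q^ m ℕ.* ℤ.∣ A + B + + 1 ∣ · G
    Z = q^ m ℕ.* ℤ.∣ B + + 1 ∣ · gaussℤ (A - + 1) (B + + 1)
    W = q^ m ℕ.* ℤ.∣ A + + 1 ∣ · gaussℤ (A + + 1) (B - + 1)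
    Z′ = q^ polygonal (k - + 1) · gaussℤ (+ N + (k - + 1)) (+ N - (k - + 1))
    W′ = q^ polygonal (k + + 1) · gaussℤ (+ N + (k + + 1)) (+ N - (k + + 1))
    shift-A : ∀ n k → (+ 1 + n) + k ≡ (n + k) + + 1
    shift-A = solve-∀
    shift-B : ∀ n k → (+ 1 + n) - k ≡ (n - k) + + 1
    shift-B = solve-∀
    A+B : ∀ n k → (n + k) + (n - k) ≡ n + n
    A+B = solve-∀
    rearrange : ∀ s g y z w → s * (g + y + z + w) ≡ s * g + s * y - (- s) * z - (- s) * w
    rearrange = solve-∀
    distribute : q^ E · (G ⊕ Y ⊕ Z ⊕ W) ≈ q^ E · G ⊕ q^ E · Y ⊕ q^ E · Z ⊕ q^ E · W
    distribute = ≈-trans (⊕-hom (q^-linear E) _ W)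
                   (⊕-cong (≈-trans (⊕-hom (q^-linear E) _ Z) (⊕-cong (⊕-hom (q^-linear E) G Y) ≈-refl)) ≈-refl)

  term-vanish : ∀ N k → gaussℤ (+ N + k) (+ N - k) ≈ 0ₛ → term N k ≈ 0ₛ
  term-vanish N k = ≈0-hom (∘-linear (•-linear (sign k)) (q^-linear (polygonal k)))

  term-below : ∀ N k j → + N + k ≡ -[1+ j ] → term N k ≈ 0ₛ
  term-below N k j eq = term-vanish N k (gaussℤ-cong eq refl)

  term-above : ∀ N k j → + N - k ≡ -[1+ j ] → term N k ≈ 0ₛ
  term-above N k j eq =
    term-vanish N k (≈-trans (gaussℤ-cong {A = + N + k} refl eq) (λ i → cong (λ f → f i) (gaussℤ-neg (+ N + k) j)))

  private
    +[N+sucN] : ∀ N → + (N ℕ.+ suc N) ≡ + N + (+ 1 + + N)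
    +[N+sucN] N = ℤP.pos-+ N (suc N)

  -- the window of jacobiSum (suc N), on which term N vanishes at both ends
  jacobiSum-widen : ∀ N → Σₛ (- + suc N) (suc (suc N ℕ.+ suc N)) (term N) ≈ jacobiSum N
  jacobiSum-widen N = begin
    Σₛ lo (suc (suc L)) (term N)        ≈⟨ Σₛ-drop-first lo (suc L) (term N) first ⟩
    Σₛ (lo + + 1) (suc L) (term N)      ≈⟨ Σₛ-drop-last (lo + + 1) L (term N) last ⟩
    Σₛ (lo + + 1) L (term N)            ≈⟨ Σₛ-index (term N) (e₃ (+ N)) (ℕP.+-suc N N) ⟩
    jacobiSum N                         ∎
    where
    open ≈-Reasoning
    lo = - + suc N
    L = N ℕ.+ suc N
    e₁ : ∀ n → n + - (+ 1 + n) ≡ - + 1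
    e₁ = solve-∀
    e₂ : ∀ n → n - (- (+ 1 + n) + + 1 + (n + (+ 1 + n))) ≡ - + 1
    e₂ = solve-∀
    e₃ : ∀ n → - (+ 1 + n) + + 1 ≡ - n
    e₃ = solve-∀
    first : term N lo ≈ 0ₛ
    first = term-below N lo 0 (e₁ (+ N))
    last : term N (lo + + 1 + + L) ≈ 0ₛ
    last = term-above N (lo + + 1 + + L) 0 (trans (cong (λ z → + N - (lo + + 1 + z)) (+[N+sucN] N)) (e₂ (+ N)))

  jacobiSum-widen-down : ∀ N → Σₛ (- + suc N + - + 1) (suc (suc N ℕ.+ suc N)) (term N) ≈ jacobiSum N
  jacobiSum-widen-down N = begin
    Σₛ lo (suc (suc L)) (term N)         ≈⟨ Σₛ-drop-first lo (suc L) (term N) first ⟩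
    Σₛ (lo + + 1) (suc L) (term N)       ≈⟨ Σₛ-drop-first (lo + + 1) L (term N) second ⟩
    Σₛ (lo + + 1 + + 1) L (term N)       ≈⟨ Σₛ-index (term N) (e₃ (+ N)) (ℕP.+-suc N N) ⟩
    jacobiSum N                          ∎
    where
    open ≈-Reasoning
    lo = - + suc N + - + 1
    L = N ℕ.+ suc N
    e₁ : ∀ n → n + (- (+ 1 + n) + - + 1) ≡ - + 2
    e₁ = solve-∀
    e₂ : ∀ n → n + (- (+ 1 + n) + - + 1 + + 1) ≡ - + 1
    e₂ = solve-∀
    e₃ : ∀ n → - (+ 1 + n) + - + 1 + + 1 + + 1 ≡ - n
    e₃ = solve-∀
    first : term N lo ≈ 0ₛ
    first = term-below N lo 1 (e₁ (+ N))
    second : term N (lo + + 1) ≈ 0ₛ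
    second = term-below N (lo + + 1) 0 (e₂ (+ N))

  jacobiSum-widen-up : ∀ N → Σₛ (- + suc N + + 1) (suc (suc N ℕ.+ suc N)) (term N) ≈ jacobiSum N
  jacobiSum-widen-up N = begin
    Σₛ lo (suc (suc L)) (term N)         ≈⟨ Σₛ-drop-last lo (suc L) (term N) last ⟩
    Σₛ lo (suc L) (term N)               ≈⟨ Σₛ-drop-last lo L (term N) second-last ⟩
    Σₛ lo L (term N)                     ≈⟨ Σₛ-index (term N) (e₃ (+ N)) (ℕP.+-suc N N) ⟩
    jacobiSum N                          ∎
    where
    open ≈-Reasoning
    lo = - + suc N + + 1
    L = N ℕ.+ suc N
    e₁ : ∀ n → n - (- (+ 1 + n) + + 1 + (+ 1 + (n + (+ 1 + n)))) ≡ - + 2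
    e₁ = solve-∀
    e₂ : ∀ n → n - (- (+ 1 + n) + + 1 + (n + (+ 1 + n))) ≡ - + 1
    e₂ = solve-∀
    e₃ : ∀ n → - (+ 1 + n) + + 1 ≡ - n
    e₃ = solve-∀
    last : term N (lo + + suc L) ≈ 0ₛ
    last = term-above N (lo + + suc L) 1 (trans (cong (λ z → + N - (lo + (+ 1 + z))) (+[N+sucN] N)) (e₁ (+ N)))
    second-last : term N (lo + + L) ≈ 0ₛ
    second-last = term-above N (lo + + L) 0 (trans (cong (λ z → + N - (lo + z)) (+[N+sucN] N)) (e₂ (+ N)))

  jacobiSum-suc : ∀ N → jacobiSum (suc N) ≈
    jacobiSum N ⊕ q^ α N ℕ.+ β N · jacobiSum N ⊝ q^ α N · jacobiSum N ⊝ q^ β N · jacobiSum N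
  jacobiSum-suc N = begin
    Σₛ lo L (term (suc N))
      ≈⟨ Σₛ-cong lo L (term-suc N) ⟩
    Σₛ lo L (λ k → τ k ⊕ q^ a+b · τ k ⊝ Down k ⊝ Up k)
      ≈⟨ Σₛ-⊝ lo L (λ k → τ k ⊕ q^ a+b · τ k ⊝ Down k) Up ⟩
    Σₛ lo L (λ k → τ k ⊕ q^ a+b · τ k ⊝ Down k) ⊝ Σₛ lo L Up
      ≈⟨ ⊝-cong (Σₛ-⊝ lo L (λ k → τ k ⊕ q^ a+b · τ k) Down) ≈-refl ⟩
    Σₛ lo L (λ k → τ k ⊕ q^ a+b · τ k) ⊝ Σₛ lo L Down ⊝ Σₛ lo L Up
      ≈⟨ ⊝-cong (⊝-cong (Σₛ-⊕ lo L τ (λ k → q^ a+b · τ k)) ≈-refl) ≈-refl ⟩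
    Σₛ lo L τ ⊕ Σₛ lo L (λ k → q^ a+b · τ k) ⊝ Σₛ lo L Down ⊝ Σₛ lo L Up
      ≈⟨ ⊝-cong (⊝-cong (⊕-cong (≈-refl {Σₛ lo L τ}) (≈-sym (Σₛ-comm (q^-linear a+b) lo L τ)))
                        (≈-sym (Σₛ-comm (q^-linear (α N)) lo L (λ k → τ (k - + 1)))))
                (≈-sym (Σₛ-comm (q^-linear (β N)) lo L (λ k → τ (k + + 1)))) ⟩
    Σₛ lo L τ ⊕ q^ a+b · Σₛ lo L τ ⊝ q^ α N · Σₛ lo L (λ k → τ (k - + 1)) ⊝ q^ β N · Σₛ lo L (λ k → τ (k + + 1))
      ≈⟨ ⊝-cong (⊝-cong (⊕-cong (jacobiSum-widen N) (cong-≈ (q^-linear a+b) (jacobiSum-widen N)))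
                        (cong-≈ (q^-linear (α N)) (≈-trans (Σₛ-shift lo L τ (- + 1)) (jacobiSum-widen-down N))))
                (cong-≈ (q^-linear (β N)) (≈-trans (Σₛ-shift lo L τ (+ 1)) (jacobiSum-widen-up N))) ⟩
    jacobiSum N ⊕ q^ a+b · jacobiSum N ⊝ q^ α N · jacobiSum N ⊝ q^ β N · jacobiSum N ∎
    where
    open ≈-Reasoning
    lo = - + suc N
    L = suc (suc N ℕ.+ suc N)
    a+b = α N ℕ.+ β N
    τ = term N
    Down Up : ℤ → Series
    Down k = q^ α N · τ (k - + 1)
    Up k = q^ β N · τ (k + + 1)

  triple-product : ∀ N → jacobiProduct N 1ₛ ≈ jacobiSum N
  triple-product zero zero = refl
  triple-product zero (suc i) = refl
  triple-product (suc N) = begin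
    jacobiProduct N ([1-q^ α N ] [1-q^ β N ] 1ₛ)
      ≈⟨ [1-q^]-comm (jacobiProduct-linear N) (α N) _ ⟩
    [1-q^ α N ] jacobiProduct N ([1-q^ β N ] 1ₛ)
      ≈⟨ cong-≈ ([1-q^]-linear (α N)) ([1-q^]-comm (jacobiProduct-linear N) (β N) 1ₛ) ⟩
    [1-q^ α N ] [1-q^ β N ] jacobiProduct N 1ₛ
      ≈⟨ cong-≈ (∘-linear ([1-q^]-linear (α N)) ([1-q^]-linear (β N))) (triple-product N) ⟩
    [1-q^ α N ] [1-q^ β N ] jacobiSum N
      ≈⟨ [1-q^]-[1-q^] (α N) (β N) (jacobiSum N) ⟩
    jacobiSum N ⊕ q^ α N ℕ.+ β N · jacobiSum N ⊝ q^ α N · jacobiSum N ⊝ q^ β N · jacobiSum N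
      ≈⟨ jacobiSum-suc N ⟨
    jacobiSum (suc N) ∎
    where open ≈-Reasoning

module Truncation (m : ℕ) (2≤m : 2 ℕ.≤ m) where

  private
    1≤m : 1 ℕ.≤ m
    1≤m = ℕP.≤-trans (s≤s z≤n) 2≤m

  open Gaussian m
  open Positive 1≤m
  open Polygonal m 1≤m
  open TripleProduct m 1≤m

  P′-≥ : ∀ x → x ℕ.≤ P′ x
  P′-≥ zero = z≤n
  P′-≥ (suc x) = subst (ℕ._≤ P′ x ℕ.+ (m ℕ.* x ℕ.+ 1)) (ℕP.+-comm x 1)
                   (ℕP.+-mono-≤ (P′-≥ x) (ℕP.m≤n+m 1 (m ℕ.* x)))

  Q′-≥ : ∀ x → x ℕ.≤ Q′ x
  Q′-≥ zero = z≤n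
  Q′-≥ (suc x) = subst (ℕ._≤ Q′ x ℕ.+ (m ℕ.* x ℕ.+ (m ℕ.∸ 1))) (ℕP.+-comm x 1)
                   (ℕP.+-mono-≤ (Q′-≥ x) (ℕP.≤-trans (ℕP.∸-monoˡ-≤ 1 2≤m) (ℕP.m≤n+m (m ℕ.∸ 1) (m ℕ.* x))))

  -- Σ_{k=-N}^{N} (-1)^k q^{polygonal k}, with the terms for k and -k grouped
  theta : ℕ → Series
  theta N = 1ₛ ⊕ Σ₁ₛ N (λ x → sgn x • q^ P′ x · 1ₛ ⊕ sgn x • q^ Q′ x · 1ₛ)

  jacobiSum-symmetric : ∀ N → jacobiSum N ≈ term N (+ 0) ⊕ Σ₁ₛ N (λ x → term N (+ x) ⊕ term N (- + x))
  jacobiSum-symmetric N i = Σℤ-symmetric N (λ k → term N k i)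

  module _ (n N : ℕ) (2n≤N : n ℕ.+ n ℕ.≤ N) where

    poch-signed-≈[] : ∀ a b c s z → c ℕ.≤ a → c ℕ.≤ b → c ℕ.≤ N → (s ℕ.≤ n → n ℕ.≤ c) →
                      poch N (z • q^ s · gauss a b) ≈[ suc n ] z • q^ s · 1ₛ
    poch-signed-≈[] a b c s z c≤a c≤b c≤N n≤c =
      ≈[]-trans (≈⇒≈[] (•q^-comm (poch-linear N) z s (gauss a b)))
        (cong-≈[] (•-linear z) (suc n) (q^-≈[]-enough s (m ℕ.* suc c) n (poch-gauss-≈[] N a b c c≤a c≤b c≤N) enough))
      where
      enough : s ℕ.≤ n → n ℕ.< s ℕ.+ m ℕ.* suc c
      enough s≤n = ℕP.≤-trans (s≤s (n≤c s≤n)) (ℕP.≤-trans (x≤m*x 1≤m (suc c)) (ℕP.m≤n+m _ s))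

    n≤N∸x : ∀ x → x ℕ.≤ n → n ℕ.≤ N ℕ.∸ x
    n≤N∸x x x≤n = ℕP.≤-trans (ℕP.≤-reflexive (sym (ℕP.m+n∸n≡m n n))) (ℕP.∸-mono 2n≤N x≤n)

    poch-term⁺-≈[] : ∀ x → x ℕ.≤ N → poch N (term N (+ x)) ≈[ suc n ] sgn x • q^ P′ x · 1ₛ
    poch-term⁺-≈[] x x≤N =
      ≈[]-trans (≈⇒≈[] (cong-≈ (poch-linear N) (cong-≈ (∘-linear (•-linear (sgn x)) (q^-linear (P′ x)))
                   (gaussℤ-cong {A = + (N ℕ.+ x)} refl (trans (ℤP.m-n≡m⊖n N x) (ℤP.⊖-≥ x≤N))))))
        (poch-signed-≈[] (N ℕ.+ x) (N ℕ.∸ x) (N ℕ.∸ x) (P′ x) (sgn x)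
           (ℕP.≤-trans (ℕP.m∸n≤m N x) (ℕP.m≤m+n N x)) ℕP.≤-refl (ℕP.m∸n≤m N x)
           (λ P′x≤n → n≤N∸x x (ℕP.≤-trans (P′-≥ x) P′x≤n)))

    poch-term⁻-≈[] : ∀ x → 1 ℕ.≤ x → x ℕ.≤ N → poch N (term N (- + x)) ≈[ suc n ] sgn x • q^ Q′ x · 1ₛ
    poch-term⁻-≈[] (suc y) _ x≤N =
      ≈[]-trans (≈⇒≈[] (cong-≈ (poch-linear N) (cong-≈ (∘-linear (•-linear (sgn x)) (q^-linear (Q′ x)))
                   (gaussℤ-cong {B = + (N ℕ.+ x)} (trans (ℤP.m-n≡m⊖n N x) (ℤP.⊖-≥ x≤N)) refl))))
        (poch-signed-≈[] (N ℕ.∸ x) (N ℕ.+ x) (N ℕ.∸ x) (Q′ x) (sgn x)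
           ℕP.≤-refl (ℕP.≤-trans (ℕP.m∸n≤m N x) (ℕP.m≤m+n N x)) (ℕP.m∸n≤m N x)
           (λ Q′x≤n → n≤N∸x x (ℕP.≤-trans (Q′-≥ x) Q′x≤n)))
      where x = suc y

    poch-jacobiSum-≈[] : poch N (jacobiSum N) ≈[ suc n ] theta N
    poch-jacobiSum-≈[] =
      ≈[]-trans (≈⇒≈[] (≈-trans (cong-≈ (poch-linear N) (jacobiSum-symmetric N))
                          (≈-trans (⊕-hom (poch-linear N) (term N (+ 0)) (Σ₁ₛ N pair))
                            (⊕-cong (≈-refl {poch N (term N (+ 0))}) (Σ₁ₛ-comm (poch-linear N) N pair)))))
        (⊕-cong-≈[] (≈[]-trans (poch-term⁺-≈[] 0 z≤n) (λ i _ → ℤP.*-identityˡ (1ₛ i)))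
          (Σ₁ₛ-cong-≈[] N (suc n) (λ x 1≤x x≤N →
            ≈[]-trans (≈⇒≈[] (⊕-hom (poch-linear N) (term N (+ x)) (term N (- + x))))
              (⊕-cong-≈[] (poch-term⁺-≈[] x x≤N) (poch-term⁻-≈[] x 1≤x x≤N)))))
      where
      pair : ℕ → Series
      pair x = term N (+ x) ⊕ term N (- + x)

module GoodProduct (m : ℕ) (3≤m : 3 ℕ.≤ m) where

  private
    1≤m : 1 ℕ.≤ m
    1≤m = ℕP.≤-trans (s≤s z≤n) 3≤m

    2≤m : 2 ℕ.≤ m
    2≤m = ℕP.≤-trans (s≤s (s≤s z≤n)) 3≤m

  open Gaussian m
  open TripleProduct m 1≤m

  private
    M : ℕ
    M = suc (m ℕ.∸ 1)

    M≡m : M ≡ m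
    M≡m = ℕP.m+[n∸m]≡n 1≤m

    goodResidue : ℕ → Bool
    goodResidue r = (r ℕ.≡ᵇ 0) ∨ (r ℕ.≡ᵇ 1) ∨ (r ℕ.≡ᵇ (m ℕ.∸ 1))

  good-periodic : ∀ N r → good m (m ℕ.* N ℕ.+ r) ≡ good m r
  good-periodic N r = cong goodResidue (trans (cong (_% M) swap) ([m+kn]%n≡m%n r N M))
    where
    swap : m ℕ.* N ℕ.+ r ≡ r ℕ.+ N ℕ.* M
    swap = trans (ℕP.+-comm _ r) (cong (r ℕ.+_) (trans (ℕP.*-comm m N) (cong (N ℕ.*_) (sym M≡m))))

  good-below : ∀ r → r ℕ.< m → good m r ≡ goodResidue r
  good-below r r<m = cong goodResidue (m<n⇒m%n≡m (subst (r ℕ.<_) (sym M≡m) r<m))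

  good-1 : good m 1 ≡ true
  good-1 = good-below 1 (ℕP.≤-trans (s≤s (s≤s z≤n)) 3≤m)

  good-m∸1 : good m (m ℕ.∸ 1) ≡ true
  good-m∸1 = trans (good-below (m ℕ.∸ 1) (ℕP.∸-monoʳ-< {m} {1} {0} (s≤s z≤n) 1≤m))
                   (trans (cong (λ b → ((m ℕ.∸ 1) ℕ.≡ᵇ 0) ∨ ((m ℕ.∸ 1) ℕ.≡ᵇ 1) ∨ b) (≡ᵇ-refl (m ℕ.∸ 1)))
                          (trans (cong (((m ℕ.∸ 1) ℕ.≡ᵇ 0) ∨_) (∨-zeroʳ _)) (∨-zeroʳ _)))
    where
    ≡ᵇ-refl : ∀ x → (x ℕ.≡ᵇ x) ≡ true
    ≡ᵇ-refl zero = refl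
    ≡ᵇ-refl (suc x) = ≡ᵇ-refl x

  good-middle : ∀ r → 2 ℕ.≤ r → r ℕ.< m ℕ.∸ 1 → good m r ≡ false
  good-middle zero () _
  good-middle (suc zero) (s≤s ()) _
  good-middle (suc (suc r)) _ r<m∸1 = trans (good-below (suc (suc r)) r<m) not-m∸1
    where
    r<m : suc (suc r) ℕ.< m
    r<m = ℕP.<-≤-trans r<m∸1 (ℕP.m∸n≤m m 1)
    not-m∸1 : (suc (suc r) ℕ.≡ᵇ (m ℕ.∸ 1)) ≡ false
    not-m∸1 with suc (suc r) ℕ.≡ᵇ (m ℕ.∸ 1) in eq
    ... | false = refl
    ... | true = ⊥-elim (ℕP.<-irrefl (ℕP.≡ᵇ⇒≡ (suc (suc r)) (m ℕ.∸ 1) (subst T (sym eq) _)) r<m∸1)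

  goodFactor : ℕ → Series → Series
  goodFactor d f = if good m d then [1-q^ d ] f else f

  goodFactor-true : ∀ d f → good m d ≡ true → goodFactor d f ≡ [1-q^ d ] f
  goodFactor-true d f eq rewrite eq = refl

  goodFactor-false : ∀ d f → good m d ≡ false → goodFactor d f ≡ f
  goodFactor-false d f eq rewrite eq = refl

  goodFactor-linear : ∀ d → IsQLinear (goodFactor d)
  goodFactor-linear d with good m d
  ... | true = [1-q^]-linear d
  ... | false = id-linear

  goodFactor-comm : ∀ {op} → IsQLinear op → ∀ d f → op (goodFactor d f) ≈ goodFactor d (op f)
  goodFactor-comm L d f with good m d
  ... | true = [1-q^]-comm L d f
  ... | false = ≈-refl

  goodProduct : ℕ → Series → Series
  goodProduct zero f = f
  goodProduct (suc d) f = goodProduct d (goodFactor (suc d) f)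

  goodProduct-linear : ∀ D → IsQLinear (goodProduct D)
  goodProduct-linear zero = id-linear
  goodProduct-linear (suc D) = ∘-linear (goodProduct-linear D) (goodFactor-linear (suc D))

  goodLog : ℕ → Series
  goodLog zero = 0ₛ
  goodLog (suc d) = goodLog d ⊕ (if good m (suc d) then ℓ (suc d) else 0ₛ)

  negLogDerivative-goodProduct : ∀ D → NegLogDerivative (goodProduct D 1ₛ) (goodLog D)
  negLogDerivative-goodProduct zero = negLogDerivative-1ₛ
  negLogDerivative-goodProduct (suc D) =
    negLogDerivative-cong {L = goodLog (suc D)} (≈-sym (goodFactor-comm (goodProduct-linear D) (suc D) 1ₛ)) ≈-refl
      (step (good m (suc D)) refl)
    where
    A = goodProduct D 1ₛ
    step : ∀ b → good m (suc D) ≡ b →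
           NegLogDerivative (goodFactor (suc D) A) (goodLog D ⊕ (if b then ℓ (suc D) else 0ₛ))
    step true eq = subst (λ B → NegLogDerivative B (goodLog D ⊕ ℓ (suc D))) (sym (goodFactor-true (suc D) A eq))
                     (negLogDerivative-[1-q^] (suc D) {A} {goodLog D} (s≤s z≤n) (negLogDerivative-goodProduct D))
    step false eq = subst (λ B → NegLogDerivative B (goodLog D ⊕ 0ₛ)) (sym (goodFactor-false (suc D) A eq))
                      (negLogDerivative-cong {A = A} ≈-refl (λ i → sym (ℤP.+-identityʳ (goodLog D i)))
                        (negLogDerivative-goodProduct D))

  goodBlock : ℕ → ℕ → Series → Series
  goodBlock d zero f = f
  goodBlock d (suc r) f = goodBlock d r (goodFactor (suc (d ℕ.+ r)) f)

  goodBlock-linear : ∀ d r → IsQLinear (goodBlock d r)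
  goodBlock-linear d zero = id-linear
  goodBlock-linear d (suc r) = ∘-linear (goodBlock-linear d r) (goodFactor-linear (suc (d ℕ.+ r)))

  goodProduct-+ : ∀ d r f → goodProduct (d ℕ.+ r) f ≈ goodProduct d (goodBlock d r f)
  goodProduct-+ d zero f rewrite ℕP.+-identityʳ d = ≈-refl
  goodProduct-+ d (suc r) f rewrite ℕP.+-suc d r = goodProduct-+ d r (goodFactor (suc (d ℕ.+ r)) f)

  goodBlock-≈[] : ∀ D r f → goodBlock D r f ≈[ suc D ] f
  goodBlock-≈[] D zero f = ≈[]-refl
  goodBlock-≈[] D (suc r) f =
    ≈[]-trans (cong-≈[] (goodBlock-linear D r) (suc D) (factor-≈[] (good m (suc (D ℕ.+ r))))) (goodBlock-≈[] D r f)
    where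
    factor-≈[] : ∀ b → (if b then [1-q^ suc (D ℕ.+ r) ] f else f) ≈[ suc D ] f
    factor-≈[] true = [1-q^]-below (suc (D ℕ.+ r)) (suc D) f (s≤s (ℕP.m≤m+n D r))
    factor-≈[] false = ≈[]-refl

  goodProduct-≈[] : ∀ D r f → goodProduct (D ℕ.+ r) f ≈[ suc D ] goodProduct D f
  goodProduct-≈[] D r f =
    ≈[]-trans (≈⇒≈[] (goodProduct-+ D r f)) (cong-≈[] (goodProduct-linear D) (suc D) (goodBlock-≈[] D r f))

  module _ (N : ℕ) where

    private
      d = m ℕ.* N

    -- among d + 1, …, d + m only d + 1, d + m - 1 and d + m are good
    goodBlock-initial : ∀ r f → 1 ℕ.≤ r → r ℕ.≤ m ℕ.∸ 2 → goodBlock d r f ≈ [1-q^ d ℕ.+ 1 ] f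
    goodBlock-initial (suc zero) f _ _ rewrite ℕP.+-identityʳ d =
      ≈-trans (λ i → cong (λ g → g i) (goodFactor-true (suc d) f (trans (cong (good m) (ℕP.+-comm 1 d))
                                                                      (trans (good-periodic N 1) good-1))))
              ([1-q^]-cong f (ℕP.+-comm 1 d))
    goodBlock-initial (suc (suc r)) f _ r≤m∸2 =
      ≈-trans (λ i → cong (λ g → goodBlock d (suc r) g i) (goodFactor-false (suc (d ℕ.+ suc r)) f bad))
              (goodBlock-initial (suc r) f (s≤s z≤n) (ℕP.<⇒≤ r≤m∸2))
      where
      bad : good m (suc (d ℕ.+ suc r)) ≡ false
      bad = trans (cong (good m) (sym (ℕP.+-suc d (suc r))))
              (trans (good-periodic N (suc (suc r)))
                (good-middle (suc (suc r)) (s≤s (s≤s z≤n))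
                  (ℕP.<-≤-trans (s≤s r≤m∸2) (ℕP.≤-reflexive (sym (ℕP.+-∸-assoc 1 2≤m))))))

    goodBlock-full : ∀ f → goodBlock d m f ≈ [1-q^ α N ] [1-q^ β N ] [1-q^ d ℕ.+ m ] f
    goodBlock-full f = begin
      goodBlock d m f
        ≈⟨ (λ i → cong (λ r → goodBlock d r f i) (sym m≡)) ⟩
      goodBlock d r (goodFactor (suc (d ℕ.+ r)) (goodFactor (suc (d ℕ.+ suc r)) f))
        ≈⟨ (λ i → cong₂ (λ g h → goodBlock d r (g h) i)
                    (cong goodFactor e₁) (cong (λ g → g f) (cong goodFactor e₂))) ⟩
      goodBlock d r (goodFactor (β N) (goodFactor (d ℕ.+ m) f))
        ≈⟨ (λ i → cong₂ (λ g h → goodBlock d r (g h) i)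
                    (cong (λ b → λ g → if b then [1-q^ β N ] g else g) good-β)
                    (goodFactor-true (d ℕ.+ m) f good-d+m)) ⟩
      goodBlock d r ([1-q^ β N ] [1-q^ d ℕ.+ m ] f)
        ≈⟨ goodBlock-initial r _ (ℕP.∸-monoˡ-≤ 2 3≤m) ℕP.≤-refl ⟩
      [1-q^ α N ] [1-q^ β N ] [1-q^ d ℕ.+ m ] f ∎
      where
      open ≈-Reasoning
      r = m ℕ.∸ 2
      m≡ : suc (suc r) ≡ m
      m≡ = ℕP.m+[n∸m]≡n 2≤m
      e₁ : suc (d ℕ.+ r) ≡ β N
      e₁ = trans (sym (ℕP.+-suc d r)) (cong (d ℕ.+_) (sym (ℕP.+-∸-assoc 1 2≤m)))
      e₂ : suc (d ℕ.+ suc r) ≡ d ℕ.+ m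
      e₂ = trans (sym (ℕP.+-suc d (suc r))) (cong (d ℕ.+_) m≡)
      good-β : good m (β N) ≡ true
      good-β = trans (good-periodic N (m ℕ.∸ 1)) good-m∸1
      good-d+m : good m (d ℕ.+ m) ≡ true
      good-d+m = trans (cong (good m) (trans (trans (ℕP.+-comm d m) (sym (ℕP.*-suc m N))) (sym (ℕP.+-identityʳ _))))
                       (good-periodic (suc N) 0)

  goodProduct-jacobiProduct : ∀ N f → goodProduct (m ℕ.* N) f ≈ poch N (jacobiProduct N f)
  goodProduct-jacobiProduct zero f rewrite ℕP.*-zeroʳ m = ≈-refl
  goodProduct-jacobiProduct (suc N) f = begin
    goodProduct (m ℕ.* suc N) f
      ≈⟨ (λ i → cong (λ D → goodProduct D f i) (trans (ℕP.*-suc m N) (ℕP.+-comm m d))) ⟩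
    goodProduct (d ℕ.+ m) f
      ≈⟨ goodProduct-+ d m f ⟩
    goodProduct d (goodBlock d m f)
      ≈⟨ cong-≈ (goodProduct-linear d) (goodBlock-full N f) ⟩
    goodProduct d ([1-q^ α N ] [1-q^ β N ] [1-q^ d ℕ.+ m ] f)
      ≈⟨ goodProduct-jacobiProduct N ([1-q^ α N ] [1-q^ β N ] [1-q^ d ℕ.+ m ] f) ⟩
    poch N (jacobiProduct N ([1-q^ α N ] [1-q^ β N ] [1-q^ d ℕ.+ m ] f))
      ≈⟨ cong-≈ (∘-linear (poch-linear N) (jacobiProduct-linear N))
           (≈-trans ([1-q^]-comm (∘-linear ([1-q^]-linear (α N)) ([1-q^]-linear (β N))) (d ℕ.+ m) f)
                    ([1-q^]-cong ([1-q^ α N ] [1-q^ β N ] f) (trans (ℕP.+-comm d m) (sym (ℕP.*-suc m N))))) ⟩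
    poch N (jacobiProduct N ([1-q^ m ℕ.* suc N ] [1-q^ α N ] [1-q^ β N ] f))
      ≈⟨ cong-≈ (poch-linear N) ([1-q^]-comm (jacobiProduct-linear N) (m ℕ.* suc N) ([1-q^ α N ] [1-q^ β N ] f)) ⟩
    poch (suc N) (jacobiProduct (suc N) f) ∎
    where
    open ≈-Reasoning
    d = m ℕ.* N

  goodDivisor? : ℕ → ℕ → Bool
  goodDivisor? t d = ⌊ d ∣? t ⌋ ∧ good m d

  goodDivisorSum : ℕ → ℕ → ℕ
  goodDivisorSum t D = sum (filter (λ d → T? (goodDivisor? t d)) (applyUpTo suc D))

  goodDivisorSum-suc : ∀ t D → goodDivisorSum t (suc D) ≡ goodDivisorSum t D ℕ.+ (if goodDivisor? t (suc D) then suc D else 0)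
  goodDivisorSum-suc t D = begin
    goodDivisorSum t (suc D)
      ≡⟨ cong (sum ∘ filter p) (sym (applyUpTo-∷ʳ suc D)) ⟩
    sum (filter p (applyUpTo suc D ++ suc D ∷ []))
      ≡⟨ cong sum (filter-++ p (applyUpTo suc D) (suc D ∷ [])) ⟩
    sum (filter p (applyUpTo suc D) ++ filter p (suc D ∷ []))
      ≡⟨ sum-++ (filter p (applyUpTo suc D)) _ ⟩
    goodDivisorSum t D ℕ.+ sum (filter p (suc D ∷ []))
      ≡⟨ cong (goodDivisorSum t D ℕ.+_) (sum-filter-singleton (goodDivisor? t) (suc D)) ⟩
    goodDivisorSum t D ℕ.+ (if goodDivisor? t (suc D) then suc D else 0) ∎
    where
    open ≡-Reasoning
    p = λ d → T? (goodDivisor? t d)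

  goodDivisorSum-stable : ∀ t r → goodDivisorSum (suc t) (suc t ℕ.+ r) ≡ goodDivisorSum (suc t) (suc t)
  goodDivisorSum-stable t zero = cong (goodDivisorSum (suc t)) (ℕP.+-identityʳ (suc t))
  goodDivisorSum-stable t (suc r) = begin
    goodDivisorSum (suc t) (suc t ℕ.+ suc r)     ≡⟨ cong (goodDivisorSum (suc t)) (ℕP.+-suc (suc t) r) ⟩
    goodDivisorSum (suc t) (suc (suc t ℕ.+ r))   ≡⟨ goodDivisorSum-suc (suc t) (suc t ℕ.+ r) ⟩
    goodDivisorSum (suc t) (suc t ℕ.+ r) ℕ.+ _   ≡⟨ cong (goodDivisorSum (suc t) (suc t ℕ.+ r) ℕ.+_) too-large ⟩
    goodDivisorSum (suc t) (suc t ℕ.+ r) ℕ.+ 0   ≡⟨ ℕP.+-identityʳ _ ⟩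
    goodDivisorSum (suc t) (suc t ℕ.+ r)         ≡⟨ goodDivisorSum-stable t r ⟩
    goodDivisorSum (suc t) (suc t)               ∎
    where
    open ≡-Reasoning
    too-large : (if goodDivisor? (suc t) (suc (suc t ℕ.+ r)) then suc (suc t ℕ.+ r) else 0) ≡ 0
    too-large with suc (suc t ℕ.+ r) ∣? suc t
    ... | yes d∣ = ⊥-elim (ℕP.<⇒≱ (s≤s (ℕP.m≤m+n (suc t) r)) (∣⇒≤ d∣))
    ... | no _ = refl

  goodLog-term : ∀ d t → (if good m d then ℓ d else 0ₛ) (suc t) ≡ + (if goodDivisor? (suc t) d then d else 0)
  goodLog-term d t with good m d
  ... | true with d ∣? suc t
  ...   | yes _ = refl
  ...   | no _ = refl
  goodLog-term d t | false with ⌊ d ∣? suc t ⌋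
  ... | true = refl
  ... | false = refl

  goodLog-suc : ∀ D t → goodLog D (suc t) ≡ + goodDivisorSum (suc t) D
  goodLog-suc zero t = refl
  goodLog-suc (suc D) t =
    trans (cong₂ _+_ (goodLog-suc D t) (goodLog-term (suc D) t))
      (trans (sym (ℤP.pos-+ (goodDivisorSum (suc t) D) _)) (cong +_ (sym (goodDivisorSum-suc (suc t) D))))

  goodLog-zero : ∀ D → goodLog D 0 ≡ + 0
  goodLog-zero zero = refl
  goodLog-zero (suc D) with good m (suc D)
  ... | true = cong (_+ + 0) (goodLog-zero D)
  ... | false = cong (_+ + 0) (goodLog-zero D)

  goodLog-σ′ : ∀ D t → t ℕ.≤ D → goodLog D t ≡ + σ'ℕ m t
  goodLog-σ′ D zero _ = goodLog-zero D
  goodLog-σ′ D (suc t) t≤D with ℕP.m≤n⇒∃[o]m+o≡n t≤D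
  ... | r , refl = trans (goodLog-suc (suc t ℕ.+ r) t) (cong +_ (goodDivisorSum-stable t r))

module PolygonalOrder (m : ℕ) (3≤m : 3 ℕ.≤ m) where

  private
    1≤m : 1 ℕ.≤ m
    1≤m = ℕP.≤-trans (s≤s z≤n) 3≤m

    2≤m : 2 ℕ.≤ m
    2≤m = ℕP.≤-trans (s≤s (s≤s z≤n)) 3≤m

  open Polygonal m 1≤m

  +[m∸2] : + (m ℕ.∸ 2) ≡ M - + 2
  +[m∸2] = trans (sym (ℤP.⊖-≥ 2≤m)) (sym (ℤP.m-n≡m⊖n m 2))

  private
    m+2∸2 : m ℕ.+ 2 ℕ.∸ 2 ≡ m
    m+2∸2 = ℕP.m+n∸n≡m m 2

    m+2∸4 : m ℕ.+ 2 ℕ.∸ 4 ≡ m ℕ.∸ 2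
    m+2∸4 = trans (sym (ℕP.∸-+-assoc (m ℕ.+ 2) 2 2)) (cong (ℕ._∸ 2) m+2∸2)

  P′≡P : ∀ k → P (m ℕ.+ 2) k ≡ P′ k
  P′≡P k = trans (cong (_/ 2) (trans (cong₂ (λ u v → k ℕ.* (u ℕ.* k ℕ.∸ v)) m+2∸2 m+2∸4) (numerator k)))
                 (m*n/n≡m (P′ k) 2)
    where
    numerator : ∀ k → k ℕ.* (m ℕ.* k ℕ.∸ (m ℕ.∸ 2)) ≡ P′ k ℕ.* 2
    numerator zero = refl
    numerator (suc j) = ℤP.+-injective (begin
      + (suc j ℕ.* (m ℕ.* suc j ℕ.∸ (m ℕ.∸ 2)))  ≡⟨ cong (λ x → + (suc j ℕ.* x)) m[j+1]∸[m∸2] ⟩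
      + (suc j ℕ.* (m ℕ.* j ℕ.+ 2))              ≡⟨ trans (ℤP.pos-* (suc j) _) (cong (+ suc j *_) (+[m*x+y] j 2)) ⟩
      (+ 1 + + j) * (M * + j + + 2)              ≡⟨ expand M (+ j) ⟩
      M * (+ 1 + + j) * (+ 1 + + j) - (M - + 2) * (+ 1 + + j) ≡⟨ double-P′ (suc j) ⟨
      + 2 * + P′ (suc j)                         ≡⟨ trans (ℤP.*-comm (+ 2) (+ P′ (suc j))) (sym (ℤP.pos-* (P′ (suc j)) 2)) ⟩
      + (P′ (suc j) ℕ.* 2)                       ∎)
      where
      open ≡-Reasoning
      expand : ∀ M J → (+ 1 + J) * (M * J + + 2) ≡ M * (+ 1 + J) * (+ 1 + J) - (M - + 2) * (+ 1 + J)
      expand = solve-∀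
      m[j+1]∸[m∸2] : m ℕ.* suc j ℕ.∸ (m ℕ.∸ 2) ≡ m ℕ.* j ℕ.+ 2
      m[j+1]∸[m∸2] = trans (cong (ℕ._∸ (m ℕ.∸ 2)) split) (trans (ℕP.m+n∸m≡n (m ℕ.∸ 2) _) (ℕP.+-comm 2 (m ℕ.* j)))
        where
        split : m ℕ.* suc j ≡ (m ℕ.∸ 2) ℕ.+ (2 ℕ.+ m ℕ.* j)
        split = trans (ℕP.*-suc m j) (trans (cong (ℕ._+ m ℕ.* j) (sym (ℕP.m∸n+n≡m 2≤m))) (ℕP.+-assoc (m ℕ.∸ 2) 2 (m ℕ.* j)))

  Q′≡Q : ∀ k → Q (m ℕ.+ 2) k ≡ Q′ k
  Q′≡Q k = trans (cong (_/ 2) (trans (cong₂ (λ u v → k ℕ.* (u ℕ.* k ℕ.+ v)) m+2∸2 m+2∸4) numerator))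
                 (m*n/n≡m (Q′ k) 2)
    where
    open ≡-Reasoning
    expand : ∀ M K → K * (M * K + (M - + 2)) ≡ M * K * K + (M - + 2) * K
    expand = solve-∀
    numerator : k ℕ.* (m ℕ.* k ℕ.+ (m ℕ.∸ 2)) ≡ Q′ k ℕ.* 2
    numerator = ℤP.+-injective (begin
      + (k ℕ.* (m ℕ.* k ℕ.+ (m ℕ.∸ 2)))
        ≡⟨ trans (ℤP.pos-* k _) (cong (+ k *_) (trans (+[m*x+y] k (m ℕ.∸ 2)) (cong (_+_ (M * + k)) +[m∸2]))) ⟩
      + k * (M * + k + (M - + 2))         ≡⟨ expand M (+ k) ⟩
      M * + k * + k + (M - + 2) * + k     ≡⟨ double-Q′ k ⟨
      + 2 * + Q′ k                        ≡⟨ trans (ℤP.*-comm (+ 2) (+ Q′ k)) (sym (ℤP.pos-* (Q′ k) 2)) ⟩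
      + (Q′ k ℕ.* 2)                      ∎)

  P′-step : ∀ x → P′ x ℕ.< P′ (suc x)
  P′-step x = ℕP.m<m+n (P′ x) (ℕP.m≤n+m 1 (m ℕ.* x))

  Q′-step : ∀ x → Q′ x ℕ.< Q′ (suc x)
  Q′-step x = ℕP.m<m+n (Q′ x) (ℕP.<-≤-trans (ℕP.∸-monoˡ-≤ 1 2≤m) (ℕP.m≤n+m (m ℕ.∸ 1) (m ℕ.* x)))

  Q′-P′ : ∀ y → Q′ y ≡ P′ y ℕ.+ (m ℕ.∸ 2) ℕ.* y
  Q′-P′ y = ℕ-from-doubled (begin
    + 2 * + Q′ y                                        ≡⟨ double-Q′ y ⟩
    M * + y * + y + (M - + 2) * + y                     ≡⟨ split M (+ y) ⟩
    (M * + y * + y - (M - + 2) * + y) + + 2 * ((M - + 2) * + y)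
                                                        ≡⟨ cong₂ (λ u v → u + + 2 * (v * + y)) (double-P′ y) +[m∸2] ⟨
    + 2 * + P′ y + + 2 * (+ (m ℕ.∸ 2) * + y)            ≡⟨ cong (λ z → + 2 * + P′ y + + 2 * z) (ℤP.pos-* (m ℕ.∸ 2) y) ⟨
    + 2 * + P′ y + + 2 * + ((m ℕ.∸ 2) ℕ.* y)            ≡⟨ double-step (P′ y) _ ⟨
    + 2 * + (P′ y ℕ.+ (m ℕ.∸ 2) ℕ.* y)                  ∎)
    where
    open ≡-Reasoning
    split : ∀ M Y → M * Y * Y + (M - + 2) * Y ≡ (M * Y * Y - (M - + 2) * Y) + + 2 * ((M - + 2) * Y)
    split = solve-∀

  P′<Q′ : ∀ y → 1 ℕ.≤ y → P′ y ℕ.< Q′ y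
  P′<Q′ y 1≤y = subst (P′ y ℕ.<_) (sym (Q′-P′ y)) (ℕP.m<m+n (P′ y) (ℕP.*-mono-≤ (ℕP.∸-monoˡ-≤ 2 3≤m) 1≤y))

  Q′<P′-suc : ∀ y → Q′ y ℕ.< P′ (suc y)
  Q′<P′-suc y = subst (ℕ._< P′ (suc y)) (sym (Q′-P′ y))
    (ℕP.+-monoʳ-< (P′ y) (ℕP.≤-<-trans (ℕP.*-monoˡ-≤ y (ℕP.m∸n≤m m 2)) (ℕP.m<m+n (m ℕ.* y) (s≤s z≤n))))

  -- the values P′ and Q′ interleave: P′ y < Q′ y < P′ (y + 1)
  P′≢Q′ : ∀ x y → 1 ℕ.≤ y → P′ x ≢ Q′ y
  P′≢Q′ x y 1≤y eq with x ℕ.≤? y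
  ... | yes x≤y = ℕP.<-irrefl eq (ℕP.≤-<-trans (increasing-≤ P′-step x≤y) (P′<Q′ y 1≤y))
  ... | no x≰y = ℕP.<-irrefl (sym eq) (ℕP.<-≤-trans (Q′<P′-suc y) (increasing-≤ P′-step (ℕP.≰⇒> x≰y)))

  hit : ℕ → ℕ → Bool
  hit n k = (P′ k ℕ.≡ᵇ n) ∨ (Q′ k ℕ.≡ᵇ n)

  hit-cases : ∀ n x → hit n x ≡ true → P′ x ≡ n ⊎ Q′ x ≡ n
  hit-cases n x h with P′ x ℕ.≡ᵇ n in eq
  ... | true = inj₁ (≡ᵇ-true eq)
  ... | false = inj₂ (≡ᵇ-true h)

  hit-unique : ∀ n x y → 1 ℕ.≤ x → 1 ℕ.≤ y → hit n x ≡ true → hit n y ≡ true → x ≡ y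
  hit-unique n x y 1≤x 1≤y hx hy with hit-cases n x hx | hit-cases n y hy
  ... | inj₁ p | inj₁ q = increasing-injective P′-step (trans p (sym q))
  ... | inj₂ p | inj₂ q = increasing-injective Q′-step (trans p (sym q))
  ... | inj₁ p | inj₂ q = ⊥-elim (P′≢Q′ x y 1≤y (trans p (sym q)))
  ... | inj₂ p | inj₁ q = ⊥-elim (P′≢Q′ y x 1≤x (trans q (sym p)))

  indicator-hit : ∀ n x → 1 ℕ.≤ x → indicator (P′ x ℕ.≡ᵇ n) + indicator (Q′ x ℕ.≡ᵇ n) ≡ indicator (hit n x)
  indicator-hit n x 1≤x with P′ x ℕ.≡ᵇ n in e₁ | Q′ x ℕ.≡ᵇ n in e₂
  ... | true | true = ⊥-elim (P′≢Q′ x x 1≤x (trans (≡ᵇ-true e₁) (sym (≡ᵇ-true e₂))))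
  ... | true | false = refl
  ... | false | true = refl
  ... | false | false = refl

  e-search-sum : ∀ n φ L → (∀ i → 1 ℕ.≤ φ i) → (∀ i j → hit n (φ i) ≡ true → hit n (φ j) ≡ true → i ≡ j) →
                 e-search (m ℕ.+ 2) n (applyUpTo φ L) ≡ Σ< L (λ i → sgn (φ i) * indicator (hit n (φ i)))
  e-search-sum n φ zero _ _ = refl
  e-search-sum n φ (suc L) pos unique = begin
    (if (P (m ℕ.+ 2) (φ 0) ℕ.≡ᵇ n) ∨ (Q (m ℕ.+ 2) (φ 0) ℕ.≡ᵇ n) then sgn (φ 0) else rest)
      ≡⟨ cong (λ b → if b then sgn (φ 0) else rest)
           (cong₂ (λ u v → (u ℕ.≡ᵇ n) ∨ (v ℕ.≡ᵇ n)) (P′≡P (φ 0)) (Q′≡Q (φ 0))) ⟩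
    (if hit n (φ 0) then sgn (φ 0) else rest)
      ≡⟨ first (hit n (φ 0)) refl ⟩
    sgn (φ 0) * indicator (hit n (φ 0)) + Σ< L (term ∘ suc)
      ≡⟨ Σ<-front L term ⟨
    Σ< (suc L) term ∎
    where
    open ≡-Reasoning
    rest = e-search (m ℕ.+ 2) n (applyUpTo (φ ∘ suc) L)
    term = λ i → sgn (φ i) * indicator (hit n (φ i))
    later : ∀ i j → hit n (φ (suc i)) ≡ true → hit n (φ (suc j)) ≡ true → i ≡ j
    later i j hi hj = ℕP.suc-injective (unique (suc i) (suc j) hi hj)
    first : ∀ b → hit n (φ 0) ≡ b → (if b then sgn (φ 0) else rest) ≡ sgn (φ 0) * indicator b + Σ< L (term ∘ suc)
    first true h₀ = sym (trans (cong₂ _+_ (ℤP.*-identityʳ (sgn (φ 0))) (Σ<-zero L (term ∘ suc) no-later-hit))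
                                (ℤP.+-identityʳ _))
      where
      no-later-hit : ∀ i → term (suc i) ≡ + 0
      no-later-hit i with hit n (φ (suc i)) in hᵢ
      ... | true = ⊥-elim (ℕP.1+n≢0 (unique (suc i) 0 hᵢ h₀))
      ... | false = ℤP.*-zeroʳ (sgn (φ (suc i)))
    first false _ = trans (e-search-sum n (φ ∘ suc) L (pos ∘ suc) later)
                          (sym (trans (cong (_+ Σ< L (term ∘ suc)) (ℤP.*-zeroʳ (sgn (φ 0)))) (ℤP.+-identityˡ _)))

  e-sum : ∀ n → 1 ℕ.≤ n → e (m ℕ.+ 2) n ≡ sum₁ n (λ x → sgn x * indicator (hit n x))
  e-sum (suc n) _ = trans (e-search-sum (suc n) suc (suc n) (λ _ → s≤s z≤n)
                             (λ i j hi hj → ℕP.suc-injective (hit-unique (suc n) _ _ (s≤s z≤n) (s≤s z≤n) hi hj)))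
                          (sym (sum₁-Σ< (suc n) _))

module Recurrence (m : ℕ) (3≤m : 3 ℕ.≤ m) where

  private
    1≤m : 1 ℕ.≤ m
    1≤m = ℕP.≤-trans (s≤s z≤n) 3≤m

    2≤m : 2 ℕ.≤ m
    2≤m = ℕP.≤-trans (s≤s (s≤s z≤n)) 3≤m

  open Gaussian m
  open Polygonal m 1≤m
  open TripleProduct m 1≤m
  open Truncation m 2≤m
  open GoodProduct m 3≤m
  open PolygonalOrder m 3≤m

  σ′-nonpos : ∀ {x} → x ℤ.≤ + 0 → σ' m x ≡ + 0
  σ′-nonpos {+ zero} _ = refl
  σ′-nonpos {+ suc _} (ℤ.+≤+ ())
  σ′-nonpos { -[1+ _ ]} _ = refl

  q^-goodLog : ∀ n s → (q^ s · goodLog n) n ≡ σ' m (+ n - + s)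
  q^-goodLog n s with shiftView s n
  ... | below n<s = trans (q^-below s (goodLog n) n<s) (sym (σ′-nonpos (ℤP.i≤j⇒i-j≤0 (ℤ.+≤+ (ℕP.<⇒≤ n<s)))))
  ... | above j = trans (q^-above s (goodLog (s ℕ.+ j)) j)
                    (trans (goodLog-σ′ (s ℕ.+ j) j (ℕP.m≤n+m j s)) (cong (σ' m) (sym +[s+j]-s)))
    where
    +[s+j]-s : + (s ℕ.+ j) - + s ≡ + j
    +[s+j]-s = trans (ℤP.m-n≡m⊖n (s ℕ.+ j) s) (trans (ℤP.⊖-≥ (ℕP.m≤m+n s j)) (cong +_ (ℕP.m+n∸m≡n s j)))

  theta-⊛ : ∀ N L → theta N ⊛ L ≈ L ⊕ Σ₁ₛ N (λ x → sgn x • q^ P′ x · L ⊕ sgn x • q^ Q′ x · L)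
  theta-⊛ N L = begin
    (1ₛ ⊕ Σ₁ₛ N pair) ⊛ L                 ≈⟨ ⊕-hom (⊛-linearˡ L) 1ₛ (Σ₁ₛ N pair) ⟩
    1ₛ ⊛ L ⊕ Σ₁ₛ N pair ⊛ L               ≈⟨ ⊕-cong (1ₛ-⊛ L) (Σ₁ₛ-comm (⊛-linearˡ L) N pair) ⟩
    L ⊕ Σ₁ₛ N (λ x → pair x ⊛ L)          ≈⟨ ⊕-cong (≈-refl {L}) (λ i → sum₁-cong N (λ x _ _ → pair-⊛ x i)) ⟩
    L ⊕ Σ₁ₛ N (λ x → sgn x • q^ P′ x · L ⊕ sgn x • q^ Q′ x · L) ∎
    where
    open ≈-Reasoning
    pair : ℕ → Series
    pair x = sgn x • q^ P′ x · 1ₛ ⊕ sgn x • q^ Q′ x · 1ₛ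
    shifted-⊛ : ∀ x s → (sgn x • q^ s · 1ₛ) ⊛ L ≈ sgn x • q^ s · L
    shifted-⊛ x s =
      ≈-trans (•q^-comm (⊛-linearˡ L) (sgn x) s 1ₛ) (cong-≈ (∘-linear (•-linear (sgn x)) (q^-linear s)) (1ₛ-⊛ L))
    pair-⊛ : ∀ x → pair x ⊛ L ≈ sgn x • q^ P′ x · L ⊕ sgn x • q^ Q′ x · L
    pair-⊛ x = ≈-trans (⊕-hom (⊛-linearˡ L) (sgn x • q^ P′ x · 1ₛ) (sgn x • q^ Q′ x · 1ₛ))
                       (⊕-cong (shifted-⊛ x (P′ x)) (shifted-⊛ x (Q′ x)))

  theta-e : ∀ N n → 1 ℕ.≤ n → n ℕ.≤ N → theta N n ≡ e (m ℕ.+ 2) n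
  theta-e N (suc n) _ n≤N = begin
    + 0 + sum₁ N (λ x → sgn x * (q^ P′ x · 1ₛ) (suc n) + sgn x * (q^ Q′ x · 1ₛ) (suc n))
      ≡⟨ ℤP.+-identityˡ _ ⟩
    sum₁ N (λ x → sgn x * (q^ P′ x · 1ₛ) (suc n) + sgn x * (q^ Q′ x · 1ₛ) (suc n))
      ≡⟨ sum₁-cong N (λ x 1≤x _ → trans (sym (ℤP.*-distribˡ-+ (sgn x) _ _))
                                   (cong (sgn x *_) (trans (cong₂ _+_ (q^-1ₛ (P′ x) (suc n)) (q^-1ₛ (Q′ x) (suc n)))
                                                           (indicator-hit (suc n) x 1≤x)))) ⟩
    sum₁ N hits
      ≡⟨ cong (λ K → sum₁ K hits) (ℕP.m+[n∸m]≡n n≤N) ⟨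
    sum₁ (suc n ℕ.+ (N ℕ.∸ suc n)) hits
      ≡⟨ sum₁-vanishing-tail (suc n) (N ℕ.∸ suc n) hits (λ x n<x _ → trans (cong (λ b → sgn x * indicator b) (no-hit x n<x))
                                                                           (ℤP.*-zeroʳ (sgn x))) ⟩
    sum₁ (suc n) hits
      ≡⟨ e-sum (suc n) (s≤s z≤n) ⟨
    e (m ℕ.+ 2) (suc n) ∎
    where
    open ≡-Reasoning
    hits = λ x → sgn x * indicator (hit (suc n) x)
    ≢⇒≡ᵇ-false : ∀ {a b} → a ≢ b → (a ℕ.≡ᵇ b) ≡ false
    ≢⇒≡ᵇ-false {a} {b} a≢b with a ℕ.≡ᵇ b in eq
    ... | true = ⊥-elim (a≢b (≡ᵇ-true eq))
    ... | false = refl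
    no-hit : ∀ x → suc n ℕ.< x → hit (suc n) x ≡ false
    no-hit x n<x = cong₂ _∨_ (≢⇒≡ᵇ-false (λ eq → ℕP.<⇒≱ n<x (subst (x ℕ.≤_) eq (P′-≥ x))))
                            (≢⇒≡ᵇ-false (λ eq → ℕP.<⇒≱ n<x (subst (x ℕ.≤_) eq (Q′-≥ x))))

  goodProduct-≈[]-theta : ∀ n → goodProduct n 1ₛ ≈[ suc n ] theta (n ℕ.+ n)
  goodProduct-≈[]-theta n =
    ≈[]-trans (≈[]-sym (goodProduct-≈[] n (m ℕ.* N ℕ.∸ n) 1ₛ))
      (≈[]-trans (≈⇒≈[] (begin
        goodProduct (n ℕ.+ (m ℕ.* N ℕ.∸ n)) 1ₛ  ≈⟨ (λ i → cong (λ D → goodProduct D 1ₛ i) (ℕP.m+[n∸m]≡n n≤mN)) ⟩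
        goodProduct (m ℕ.* N) 1ₛ                ≈⟨ goodProduct-jacobiProduct N 1ₛ ⟩
        poch N (jacobiProduct N 1ₛ)             ≈⟨ cong-≈ (poch-linear N) (triple-product N) ⟩
        poch N (jacobiSum N)                    ∎))
        (poch-jacobiSum-≈[] n N ℕP.≤-refl))
    where
    open ≈-Reasoning
    N = n ℕ.+ n
    n≤mN : n ℕ.≤ m ℕ.* N
    n≤mN = ℕP.≤-trans (ℕP.m≤m+n n n) (x≤m*x 1≤m N)

  shiftedSum : ℕ → ℕ → ℤ
  shiftedSum N n = sum₁ N (λ x → sgn x * (σ' m (+ n - + P′ x) + σ' m (+ n - + Q′ x)))

  -- the coefficient of q^n in qD A + A ⊛ L = 0, for A the product of the (1 - q^d) over good d ≤ n
  coefficient-identity : ∀ n → 1 ℕ.≤ n → + n * e (m ℕ.+ 2) n + (σ' m (+ n) + shiftedSum (n ℕ.+ n) n) ≡ + 0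
  coefficient-identity n 1≤n = begin
    + n * e (m ℕ.+ 2) n + (σ' m (+ n) + shiftedSum N n)
      ≡⟨ cong₂ (λ u v → + n * u + v) (theta-e N n 1≤n (ℕP.m≤m+n n n)) convolution ⟨
    + n * θ n + (θ ⊛ L) n
      ≡⟨ cong₂ (λ u v → + n * u + v) (A≈θ n n<1+n) (cong-≈[] (⊛-linearˡ L) (suc n) A≈θ n n<1+n) ⟨
    + n * A n + (A ⊛ L) n
      ≡⟨ negLogDerivative-goodProduct n n ⟩
    + 0 ∎
    where
    open ≡-Reasoning
    N = n ℕ.+ n
    A = goodProduct n 1ₛ
    L = goodLog n
    θ = theta N
    n<1+n = ℕP.n<1+n n
    A≈θ = goodProduct-≈[]-theta n
    convolution : (θ ⊛ L) n ≡ σ' m (+ n) + shiftedSum N n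
    convolution = trans (theta-⊛ N L n)
      (cong₂ _+_ (goodLog-σ′ n n ℕP.≤-refl)
        (sum₁-cong N (λ x _ _ → trans (sym (ℤP.*-distribˡ-+ (sgn x) _ _))
                                   (cong (sgn x *_) (cong₂ _+_ (q^-goodLog n (P′ x)) (q^-goodLog n (Q′ x)))))))

  shiftedSum-reindex : ∀ n → - shiftedSum (suc n ℕ.+ suc n) (suc n) ≡
    sum₁ n (λ k → sgn (k ℕ.+ 1) * (σ' m (+ suc n - + P (m ℕ.+ 2) k) + σ' m (+ suc n - + Q (m ℕ.+ 2) k)))
  shiftedSum-reindex n = begin
    - sum₁ (suc n ℕ.+ suc n) g  ≡⟨ cong (λ K → - sum₁ K g) (sym (ℕP.+-suc n (suc n))) ⟩
    - sum₁ (n ℕ.+ suc (suc n)) g ≡⟨ cong -_ (sum₁-vanishing-tail n (suc (suc n)) g beyond) ⟩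
    - sum₁ n g                  ≡⟨ sum₁-neg n g ⟨
    sum₁ n (λ x → - g x)        ≡⟨ sum₁-cong n (λ k _ _ → trans (ℤP.neg-distribˡ-* (sgn k) _)
                                     (cong₂ _*_ (trans (sym (sgn-suc k)) (cong sgn (ℕP.+-comm 1 k)))
                                                (cong₂ (λ u v → σ' m (+ suc n - + u) + σ' m (+ suc n - + v))
                                                       (sym (P′≡P k)) (sym (Q′≡Q k))))) ⟩
    sum₁ n (λ k → sgn (k ℕ.+ 1) * (σ' m (+ suc n - + P (m ℕ.+ 2) k) + σ' m (+ suc n - + Q (m ℕ.+ 2) k))) ∎
    where
    open ≡-Reasoning
    g = λ x → sgn x * (σ' m (+ suc n - + P′ x) + σ' m (+ suc n - + Q′ x))
    vanish : ∀ {s x} → suc n ℕ.≤ x → x ℕ.≤ s → σ' m (+ suc n - + s) ≡ + 0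
    vanish n<x x≤s = σ′-nonpos (ℤP.i≤j⇒i-j≤0 (ℤ.+≤+ (ℕP.≤-trans n<x x≤s)))
    beyond : ∀ x → n ℕ.< x → x ℕ.≤ n ℕ.+ suc (suc n) → g x ≡ + 0
    beyond x n<x _ = trans (cong (sgn x *_) (cong₂ _+_ (vanish n<x (P′-≥ x)) (vanish n<x (Q′-≥ x)))) (ℤP.*-zeroʳ (sgn x))

theorem9 : (m : ℕ) → (m≥3 : m ℕ.≥ 3) → (n : ℕ) → (n≥1 : n ℕ.≥ 1) →
    σ' m (+ n)
      ≡ - ((+ n) * e (m ℕ.+ 2) n)
        + sum₁ (n ℕ.∸ 1) (λ k → sgn (k ℕ.+ 1) * (σ' m ((+ n) - (+ P (m ℕ.+ 2) k)) + σ' m ((+ n) - (+ Q (m ℕ.+ 2) k))))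
theorem9 m m≥3 (suc n) _ = begin
  σ' m (+ suc n)
    ≡⟨ isolate {+ suc n * e (m ℕ.+ 2) (suc n)} (coefficient-identity (suc n) (s≤s z≤n)) ⟩
  - (+ suc n * e (m ℕ.+ 2) (suc n)) + - shiftedSum (suc n ℕ.+ suc n) (suc n)
    ≡⟨ cong (_+_ (- (+ suc n * e (m ℕ.+ 2) (suc n)))) (shiftedSum-reindex n) ⟩
  - (+ suc n * e (m ℕ.+ 2) (suc n))
    + sum₁ n (λ k → sgn (k ℕ.+ 1) * (σ' m (+ suc n - + P (m ℕ.+ 2) k) + σ' m (+ suc n - + Q (m ℕ.+ 2) k))) ∎
  where
  open ≡-Reasoning
  open Recurrence m m≥3
  isolate : ∀ {x y z} → x + (y + z) ≡ + 0 → y ≡ - x + - z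
  isolate {x} {y} {z} h = trans (rearrange x y z) (trans (cong (_+ (- x + - z)) h) (ℤP.+-identityˡ _))
    where
    rearrange : ∀ x y z → y ≡ (x + (y + z)) + (- x + - z)
    rearrange = solve-∀
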